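{- Let $G$ be a connected graph with a modular partition $P=\{M_1,\dots,M_k\}$. Let $T$ be a poly-star MAD tree of $G$ with root $r\in M_i$. For each $j\in[k]\setminus\{i\}$ let $d_j\in M_j$ satisfy $\deg_T(d_j)\ge\deg_T(v)$ for all $v\in M_j$, let $d_i=r$, and let $D=\{d_1,\dots,d_k\}$. Then: (i) $T[D]$ is a tree; (ii) for every non-root module $M_j\in P\setminus\{M_i\}$ and every leaf $v\in M_j\setminus\{d_j\}$ it holds that $N_T(v)=\{c_j\}$, where $c_j$ is the unique vertex of $V(P^{T[D]}_{r,d_j})\cap N_T(d_j)$; (iii) letting $R=T-(M_i\setminus N_T[r])$, there is a vertex $c_i\in\arg\min_{w\in N_T(r)\cap D}\mathrm{dist}_R(w)$ such that $N_T(v)=\{c_i\}$ for all leaves $v\in M_i\setminus N_T[r]$.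
   Context: Graphs are simple, undirected, unweighted. For a graph $H$ and vertex $v$, $\mathrm{dist}_H(v)=\sum_{u\in V(H)}\mathrm{dist}_H(u,v)$; $N_H(v)$, $N_H[v]$ are open/closed neighborhoods; $H-X$ deletes vertex set $X$; $P^T_{u,v}$ is the unique $u$-$v$ path in a tree $T$. The Wiener index is $\mathrm{W}(H)=\sum_{\{u,v\}\subseteq V(H)}\mathrm{dist}_H(u,v)$; a MAD tree of $G$ is a spanning tree of minimum Wiener index. A module of $G$ is a set $M\subseteq V(G)$ such that every vertex outside $M$ is adjacent to all or to none of the vertices of $M$; a modular partition is a partition of $V(G)$ into $k\ge2$ modules. A vertex $r$ is a root of a MAD tree $T$ if every path in $T$ starting at $r$ is an induced path in $G$. A spanning tree is a poly-star (with respect to $P$) if every module of $P$ contains at most one vertex of degree at least $2$ in the tree. -}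

module Defs where

open import Data.Nat using (ℕ; zero; suc; _+_; _≤_; _<_; _<ᵇ_)
open import Data.Bool using (Bool; true; false; _∧_; _∨_; not; if_then_else_)
open import Data.Fin using (Fin; toℕ)
open import Data.Fin.Properties using (_≟_)
open import Data.List using (List; []; _∷_; length; lookup; allFin; head; last; foldr; map)
open import Data.Bool.ListAction using (any)
open import Data.List.Relation.Unary.All using (All)
open import Data.List.Relation.Unary.Linked using (Linked)
open import Data.List.Relation.Unary.Unique.Propositional using (Unique)
open import Data.Maybe using (Maybe; just; nothing)
open import Data.Product using (Σ; _×_)
open import Data.Unit using (⊤)
open import Data.Empty using (⊥)
open import Relation.Nullary using (¬_; does)
open import Relation.Binary.PropositionalEquality using (_≡_; _≢_)

record Graph (n : ℕ) : Set where
  field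
    adj    : Fin n → Fin n → Bool
    sym    : ∀ u v → adj u v ≡ adj v u
    irrefl : ∀ v → adj v v ≡ false
open Graph public

-- A "subgraph" is described by a vertex set S (Bool predicate) and an
-- edge relation E on Fin n; its edges are the E-edges inside S.
VSet : ℕ → Set
VSet n = Fin n → Bool

EdgeRel : ℕ → Set
EdgeRel n = Fin n → Fin n → Bool

allV : ∀ {n} → VSet n
allV _ = true

_==_ : ∀ {n} → Fin n → Fin n → Bool
u == v = does (u ≟ v)

IsWalk : ∀ {n} → VSet n → EdgeRel n → List (Fin n) → Set
IsWalk S E p = All (λ v → S v ≡ true) p × Linked (λ a b → E a b ≡ true) p

IsPath : ∀ {n} → VSet n → EdgeRel n → List (Fin n) → Set
IsPath S E p = IsWalk S E p × Unique p

Ends : ∀ {n} → List (Fin n) → Fin n → Fin n → Set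
Ends p u v = (head p ≡ just u) × (last p ≡ just v)

Connected : ∀ {n} → VSet n → EdgeRel n → Set
Connected S E = ∀ u v → S u ≡ true → S v ≡ true →
  Σ (List _) (λ p → IsPath S E p × Ends p u v)

IsCycle : ∀ {n} → VSet n → EdgeRel n → List (Fin n) → Set
IsCycle S E p = IsPath S E p × (3 ≤ length p) ×
  Σ (Fin _) (λ a → Σ (Fin _) (λ b → head p ≡ just a × last p ≡ just b × E b a ≡ true))

Acyclic : ∀ {n} → VSet n → EdgeRel n → Set
Acyclic S E = ∀ p → ¬ IsCycle S E p

IsTree : ∀ {n} → VSet n → EdgeRel n → Set
IsTree S E = Connected S E × Acyclic S E

count : ∀ {n} → (Fin n → Bool) → ℕ
count {n} f = foldr (λ v acc → (if f v then 1 else 0) + acc) 0 (allFin n)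

deg : ∀ {n} → Graph n → Fin n → ℕ
deg T v = count (adj T v)

-- Extended naturals (nothing = ∞) for distances

_+∞_ : Maybe ℕ → Maybe ℕ → Maybe ℕ
just a +∞ just b = just (a + b)
_ +∞ _ = nothing

_≤∞_ : Maybe ℕ → Maybe ℕ → Set
just a ≤∞ just b = a ≤ b
_ ≤∞ nothing = ⊤
nothing ≤∞ just _ = ⊥

Σ∞ : ∀ {n} → (Fin n → Bool) → (Fin n → Maybe ℕ) → Maybe ℕ
Σ∞ {n} S f = foldr (λ v acc → (if S v then f v else just 0) +∞ acc) (just 0) (allFin n)

reach : ∀ {n} → VSet n → EdgeRel n → ℕ → Fin n → Fin n → Bool
reach S E zero u v = S u ∧ (u == v)
reach {n} S E (suc k) u v =
  reach S E k u v ∨ (S v ∧ any (λ w → reach S E k u w ∧ E w v) (allFin n))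

firstUpTo : (ℕ → Bool) → ℕ → ℕ → Maybe ℕ
firstUpTo P from zero = if P from then just from else nothing
firstUpTo P from (suc b) = if P from then just from else firstUpTo P (suc from) b

-- graph distance in (S,E); nothing (= ∞) if v is unreachable from u
-- (a shortest walk has at most n edges, so searching k ≤ n suffices)
dist : ∀ {n} → VSet n → EdgeRel n → Fin n → Fin n → Maybe ℕ
dist {n} S E u v = firstUpTo (λ k → reach S E k u v) 0 n

-- dist_H(v) = Σ_{u ∈ V(H)} dist_H(u,v)
distSum : ∀ {n} → VSet n → EdgeRel n → Fin n → Maybe ℕ
distSum S E v = Σ∞ S (λ u → dist S E u v)

Wiener : ∀ {n} → Graph n → Maybe ℕ
Wiener T = Σ∞ allV (λ u → Σ∞ (λ v → toℕ u <ᵇ toℕ v) (λ v → dist allV (adj T) u v))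

IsSpanningTree : ∀ {n} → Graph n → Graph n → Set
IsSpanningTree G T = (∀ u v → adj T u v ≡ true → adj G u v ≡ true) × IsTree allV (adj T)

IsMAD : ∀ {n} → Graph n → Graph n → Set
IsMAD G T = IsSpanningTree G T × (∀ T' → IsSpanningTree G T' → Wiener T ≤∞ Wiener T')

-- Modular partitions, given as a map part : V → Fin k (module index)

IsModularPartition : ∀ {n k} → Graph n → (Fin n → Fin k) → Set
IsModularPartition {n} {k} G part =
  (2 ≤ k) ×
  (∀ j → Σ (Fin n) (λ v → part v ≡ j)) ×
  (∀ j x y v → part x ≡ j → part y ≡ j → part v ≢ j → adj G v x ≡ adj G v y)

IsPolyStar : ∀ {n k} → (Fin n → Fin k) → Graph n → Set
IsPolyStar part T = ∀ u v → part u ≡ part v → 2 ≤ deg T u → 2 ≤ deg T v → u ≡ v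

-- every path in T starting at r is an induced path in G
IsRoot : ∀ {n} → Graph n → Graph n → Fin n → Set
IsRoot G T r = ∀ p → IsPath allV (adj T) p → head p ≡ just r →
  ∀ (a b : Fin (length p)) → suc (toℕ a) < toℕ b → adj G (lookup p a) (lookup p b) ≡ false

NbhdIsSingleton : ∀ {n} → Graph n → Fin n → Fin n → Set
NbhdIsSingleton T v c = ∀ w → (adj T v w ≡ true → w ≡ c) × (w ≡ c → adj T v w ≡ true)

Dset : ∀ {n k} → (Fin k → Fin n) → VSet n
Dset {n} {k} d v = any (λ j → d j == v) (allFin k)

-- V(R) for R = T − (M_i ∖ N_T[r]), where M_i is the module of r
Rset : ∀ {n k} → (Fin n → Fin k) → Graph n → Fin n → VSet n
Rset part T r v = not ((part v == part r) ∧ not ((v == r) ∨ adj T r v))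

{-# OPTIONS --safe #-}
module Submission where

-- Everything rests on one exchange argument. Let a vertex set S hang from a single vertex h of the
-- MAD tree T, and let every vertex of S adjacent to h be G-adjacent to some h′ ∉ S. If re-attaching
-- S at h′ yields a tree T′, then W(T) ≤ W(T′) amounts to Σ_{w∉S} d(h,w) ≤ Σ_{w∉S} d(h′,w).
--
-- (i) Paths from r are induced and Mᵢ is a module, so a path from r to a vertex outside Mᵢ leaves Mᵢ
-- at once and never comes back; its inner vertices branch, hence lie in D by the poly-star property
-- and the choice of the dⱼ.
-- (ii) A leaf v ∈ Mⱼ hanging at x can be re-attached at c, and the branch behind dⱼ can be
-- re-attached at x; the two inequalities force x = c.
-- (iii) Every vertex of Mᵢ ∖ N[r] is a leaf hanging at a neighbour of r outside Mᵢ (otherwise some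
-- re-attachment would improve T), all of them hang at the same vertex, and comparing that vertex
-- with any other neighbour of r in D is once more the exchange argument.

open import Defs hiding (sym)
open import Data.Bool using (Bool; true; false; T; _∧_; _∨_; not; if_then_else_)
open import Data.Bool.ListAction using (any)
open import Data.Bool.Properties using (T-≡; ∨-comm; ∨-zeroʳ)
import Data.Bool.Properties as Bool
open import Data.Empty using (⊥; ⊥-elim)
open import Data.Fin using (Fin; zero; suc; toℕ)
open import Data.Fin.Properties using (_≟_; pigeonhole; toℕ-injective)
import Data.Fin.Properties as Fin
open import Data.List using (List; []; _∷_; _++_; _∷ʳ_; length; head; last; lookup; foldr; tabulate; allFin; filter)
open import Data.List.Membership.Propositional using (_∈_; _∉_)
open import Data.List.Membership.Propositional.Properties
  using (∈-lookup; ∈-allFin; ∈-++⁺ˡ; ∈-++⁺ʳ; ∈-++⁻; ∈-∃++; ∈-filter⁺)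
import Data.List.Membership.DecPropositional as DecMembership
open import Data.List.Properties using (++-assoc; ∷-injective; ∷ʳ-++; length-++)
open import Data.List.Relation.Unary.All using (All; []; _∷_)
import Data.List.Relation.Unary.All as All
open import Data.List.Relation.Unary.All.Properties using (¬Any⇒All¬; all-filter)
open import Data.List.Relation.Unary.AllPairs using ([]; _∷_)
import Data.List.Relation.Unary.AllPairs as AllPairs
open import Data.List.Relation.Unary.Any using (here; there; satisfied)
import Data.List.Relation.Unary.Any as Any
open import Data.List.Relation.Unary.Any.Properties using (any⁺; any⁻)
open import Data.List.Relation.Unary.Linked using (Linked; []; [-]; _∷_)
import Data.List.Relation.Unary.Linked as Linked
open import Data.List.Relation.Unary.Unique.Propositional using (Unique)
open import Data.Maybe using (Maybe; just)
import Data.Maybe.Properties as Maybe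
open import Data.Nat using (ℕ; zero; suc; _+_; _*_; _∸_; _≤_; _<_; z≤n; s≤s; _≤?_; _<ᵇ_; >-nonZero)
open import Data.Nat.Properties hiding (_≟_)
open import Algebra.Properties.Semiring.Sum +-*-semiring
  using (sum; sum-cong-≗; sum-replicate-zero; ∑-distrib-+; ∑-comm; *-distribˡ-sum)
open import Data.List.Extrema ≤-totalOrder using (argmin; argmin-all; f[argmin]≤f[xs])
open import Data.Product using (Σ; ∃; ∃-syntax; _×_; _,_; proj₁; proj₂)
open import Data.Sum using (_⊎_; inj₁; inj₂; [_,_]′)
open import Function using (_∘_)
open import Function.Bundles using (Equivalence)
open import Relation.Binary.Definitions using (tri<; tri≈; tri>)
open import Relation.Binary.PropositionalEquality
open import Relation.Nullary using (¬_; ¬?; yes; no; contradiction)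
open import Relation.Nullary.Decidable using (dec-true; dec-false)
open import Relation.Unary using (Decidable)

==-refl : ∀ {n} (u : Fin n) → (u == u) ≡ true
==-refl u = dec-true (u ≟ u) refl

==⇒≡ : ∀ {n} {u v : Fin n} → (u == v) ≡ true → u ≡ v
==⇒≡ {u = u} {v} eq with u ≟ v
... | yes u≡v = u≡v

≢⇒==-false : ∀ {n} {u v : Fin n} → u ≢ v → (u == v) ≡ false
≢⇒==-false {u = u} {v} = dec-false (u ≟ v)

≡⇒== : ∀ {n} {u v : Fin n} → u ≡ v → (u == v) ≡ true
≡⇒== {u = u} refl = ==-refl u

true≢false : true ≢ false
true≢false ()

∧-trueˡ : ∀ {a b} → a ∧ b ≡ true → a ≡ true
∧-trueˡ {true} _ = refl

∧-trueʳ : ∀ {a b} → a ∧ b ≡ true → b ≡ true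
∧-trueʳ {true} eq = eq

∧-true : ∀ {a b} → a ≡ true → b ≡ true → a ∧ b ≡ true
∧-true refl refl = refl

∨-false⁻ : ∀ {a b} → a ∨ b ≡ false → a ≡ false × b ≡ false
∨-false⁻ {false} eq = refl , eq

∨-true⁻ : ∀ {a b} → a ∨ b ≡ true → a ≡ true ⊎ b ≡ true
∨-true⁻ {true} _ = inj₁ refl
∨-true⁻ {false} eq = inj₂ eq

not-true : ∀ {a} → not a ≡ true → a ≡ false
not-true {false} _ = refl

not-false : ∀ {a} → not a ≡ false → a ≡ true
not-false {true} _ = refl

bool-cases : (b : Bool) → b ≡ true ⊎ b ≡ false
bool-cases true = inj₁ refl
bool-cases false = inj₂ refl

𝟙[_] : Bool → ℕ
𝟙[ b ] = if b then 1 else 0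

size : ∀ {n} → (Fin n → Bool) → ℕ
size S = sum (λ w → 𝟙[ S w ])

sumInside sumOutside : ∀ {n} → (Fin n → Bool) → (Fin n → ℕ) → ℕ
sumInside S f = sum (λ w → if S w then f w else 0)
sumOutside S f = sum (λ w → if S w then 0 else f w)

sum-mono-≤ : ∀ {n} {f g : Fin n → ℕ} → (∀ i → f i ≤ g i) → sum f ≤ sum g
sum-mono-≤ {zero} _ = z≤n
sum-mono-≤ {suc n} f≤g = +-mono-≤ (f≤g zero) (sum-mono-≤ (f≤g ∘ suc))

term≤sum : ∀ {n} (f : Fin n → ℕ) (i : Fin n) → f i ≤ sum f
term≤sum f zero = m≤m+n _ _
term≤sum f (suc i) = ≤-trans (term≤sum (f ∘ suc) i) (m≤n+m _ _)

two-terms≤sum : ∀ {n} (f : Fin n → ℕ) {i j : Fin n} → i ≢ j → f i + f j ≤ sum f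
two-terms≤sum f {zero} {zero} i≢j = contradiction refl i≢j
two-terms≤sum f {zero} {suc j} _ = +-monoʳ-≤ (f zero) (term≤sum (f ∘ suc) j)
two-terms≤sum f {suc i} {zero} _ =
  subst (_≤ sum f) (+-comm (f zero) (f (suc i))) (+-monoʳ-≤ (f zero) (term≤sum (f ∘ suc) i))
two-terms≤sum f {suc i} {suc j} i≢j =
  ≤-trans (two-terms≤sum (f ∘ suc) (i≢j ∘ cong suc)) (m≤n+m _ (f zero))

sum-at : ∀ {n} (a : Fin n) (f : Fin n → ℕ) → sum (λ i → if i == a then f i else 0) ≡ f a
sum-at {suc n} zero f = trans (cong (f zero +_) (sum-replicate-zero n)) (+-identityʳ _)
sum-at {suc n} (suc a) f = sum-at a (f ∘ suc)

sumInside-const : ∀ {n} (S : Fin n → Bool) (c : ℕ) → sumInside S (λ _ → c) ≡ c * size S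
sumInside-const S c = trans (sum-cong-≗ pointwise) (sym (*-distribˡ-sum c (λ w → 𝟙[ S w ])))
  where
    pointwise : ∀ w → (if S w then c else 0) ≡ c * 𝟙[ S w ]
    pointwise w with S w
    ... | true = sym (*-identityʳ c)
    ... | false = sym (*-zeroʳ c)

0<size : ∀ {n} (S : Fin n → Bool) {s} → S s ≡ true → 0 < size S
0<size S {s} s∈S = ≤-trans (≤-reflexive (cong 𝟙[_] (sym s∈S))) (term≤sum (λ w → 𝟙[ S w ]) s)

0<sum⇒term : ∀ {n} (f : Fin n → ℕ) → 0 < sum f → ∃[ i ] 0 < f i
0<sum⇒term {suc n} f 0<Σ with f zero in eq
... | suc _ = zero , subst (0 <_) (sym eq) (s≤s z≤n)
... | zero with 0<sum⇒term (f ∘ suc) 0<Σ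
...   | i , 0<fi = suc i , 0<fi

foldr-tabulate : ∀ {A : Set} {n} (h : Fin n → A) (g : A → ℕ) →
  foldr (λ v acc → g v + acc) 0 (tabulate h) ≡ sum (g ∘ h)
foldr-tabulate {n = zero} h g = refl
foldr-tabulate {n = suc n} h g = cong (g (h zero) +_) (foldr-tabulate (h ∘ suc) g)

count≡size : ∀ {n} (f : Fin n → Bool) → count f ≡ size f
count≡size f = foldr-tabulate (λ v → v) (λ v → 𝟙[ f v ])

Σ∞-tabulate : ∀ {A : Set} {n} (h : Fin n → A) (S : A → Bool) (f : A → Maybe ℕ) (g : A → ℕ) →
  (∀ i → S (h i) ≡ true → f (h i) ≡ just (g (h i))) →
  foldr (λ v acc → (if S v then f v else just 0) +∞ acc) (just 0) (tabulate h)
    ≡ just (sum (λ i → if S (h i) then g (h i) else 0))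
Σ∞-tabulate {n = zero} h S f g finite = refl
Σ∞-tabulate {n = suc n} h S f g finite
  rewrite Σ∞-tabulate (h ∘ suc) S f g (finite ∘ suc) with S (h zero) in eq
... | true rewrite finite zero eq = refl
... | false = refl

Σ∞-finite : ∀ {n} (S : VSet n) (f : Fin n → Maybe ℕ) (g : Fin n → ℕ) →
  (∀ i → S i ≡ true → f i ≡ just (g i)) → Σ∞ S f ≡ just (sumInside S g)
Σ∞-finite S f g = Σ∞-tabulate (λ v → v) S f g

sumInside-mono-≤ : ∀ {n} (S : Fin n → Bool) {f g : Fin n → ℕ} → (∀ {w} → S w ≡ true → f w ≤ g w) →
  sumInside S f ≤ sumInside S g
sumInside-mono-≤ S f≤g = sum-mono-≤ pointwise
  where
    pointwise : ∀ w → (if S w then _ else 0) ≤ (if S w then _ else 0)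
    pointwise w with S w in s
    ... | true = f≤g s
    ... | false = z≤n

sumInside-cong : ∀ {n} (S : Fin n → Bool) {f g : Fin n → ℕ} → (∀ {w} → S w ≡ true → f w ≡ g w) →
  sumInside S f ≡ sumInside S g
sumInside-cong S f≡g = sum-cong-≗ pointwise
  where
    pointwise : ∀ w → (if S w then _ else 0) ≡ (if S w then _ else 0)
    pointwise w with S w in s
    ... | true = f≡g s
    ... | false = refl

sumOutside-split : ∀ {n} (A B : Fin n → Bool) (f : Fin n → ℕ) → (∀ {w} → B w ≡ true → A w ≡ false) →
  sumOutside A f ≡ sumOutside (λ w → A w ∨ B w) f + sumInside B f
sumOutside-split A B f disjoint =
  trans (sum-cong-≗ pointwise) (∑-distrib-+ (λ w → if A w ∨ B w then 0 else f w) (λ w → if B w then f w else 0))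
  where
    pointwise : ∀ w → (if A w then 0 else f w) ≡ (if A w ∨ B w then 0 else f w) + (if B w then f w else 0)
    pointwise w with A w in a | B w in b
    ... | true | true = contradiction (trans (sym a) (disjoint b)) true≢false
    ... | true | false = refl
    ... | false | true = refl
    ... | false | false = sym (+-identityʳ _)

sumOutside-cong : ∀ {n} (S : Fin n → Bool) {f g : Fin n → ℕ} → (∀ {w} → S w ≡ false → f w ≡ g w) →
  sumOutside S f ≡ sumOutside S g
sumOutside-cong S f≡g = sum-cong-≗ pointwise
  where
    pointwise : ∀ w → (if S w then 0 else _) ≡ (if S w then 0 else _)
    pointwise w with S w in s
    ... | true = refl
    ... | false = f≡g s

sumOutside-+ : ∀ {n} (S : Fin n → Bool) (f g : Fin n → ℕ) →
  sumOutside S (λ w → f w + g w) ≡ sumOutside S f + sumOutside S g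
sumOutside-+ S f g =
  trans (sum-cong-≗ pointwise) (∑-distrib-+ (λ w → if S w then 0 else f w) (λ w → if S w then 0 else g w))
  where
    pointwise : ∀ w → (if S w then 0 else f w + g w) ≡ (if S w then 0 else f w) + (if S w then 0 else g w)
    pointwise w with S w
    ... | true = refl
    ... | false = refl

sumOutside-∨-comm : ∀ {n} (A B : Fin n → Bool) (f : Fin n → ℕ) →
  sumOutside (λ w → A w ∨ B w) f ≡ sumOutside (λ w → B w ∨ A w) f
sumOutside-∨-comm A B f = sum-cong-≗ λ w → cong (λ b → if b then 0 else f w) (∨-comm (A w) (B w))

argmin-on : ∀ {m} (P : Fin m → Bool) (g : Fin m → ℕ) {w₀} → P w₀ ≡ true →
  ∃[ c ] P c ≡ true × (∀ {w} → P w ≡ true → g c ≤ g w)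
argmin-on {m} P g {w₀} P₀ =
  argmin g w₀ candidates ,
  argmin-all g P₀ (all-filter P? (allFin m)) ,
  λ Pw → All.lookup (f[argmin]≤f[xs] w₀ candidates) (∈-filter⁺ P? (∈-allFin _) Pw)
  where
    P? : Decidable (λ w → P w ≡ true)
    P? w = P w Bool.≟ true
    candidates : List (Fin m)
    candidates = filter P? (allFin m)

Unique-++⁻ʳ : ∀ {A : Set} (pre : List A) {ys} → Unique (pre ++ ys) → Unique ys
Unique-++⁻ʳ [] u = u
Unique-++⁻ʳ (x ∷ pre) (_ ∷ u) = Unique-++⁻ʳ pre u

unique-lookup-injective : ∀ {A : Set} {xs : List A} → Unique xs →
  ∀ {i j} → lookup xs i ≡ lookup xs j → i ≡ j
unique-lookup-injective {xs = x ∷ xs} _ {zero} {zero} _ = refl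
unique-lookup-injective {xs = x ∷ xs} (x∉xs ∷ _) {zero} {suc j} eq =
  contradiction eq (All.lookup x∉xs (∈-lookup j))
unique-lookup-injective {xs = x ∷ xs} (x∉xs ∷ _) {suc i} {zero} eq =
  contradiction (sym eq) (All.lookup x∉xs (∈-lookup i))
unique-lookup-injective {xs = x ∷ xs} (_ ∷ u) {suc i} {suc j} eq =
  cong suc (unique-lookup-injective u eq)

unique-length≤ : ∀ {n} {xs : List (Fin n)} → Unique xs → length xs ≤ n
unique-length≤ {n} {xs} u with length xs ≤? n
... | yes ≤n = ≤n
... | no >n with pigeonhole (≰⇒> >n) (lookup xs)
...   | i , j , i<j , eq = contradiction (unique-lookup-injective u eq) (Fin.<⇒≢ i<j)

module _ {A : Set} where

  last-++-∷ : ∀ (xs : List A) x ys → last (xs ++ x ∷ ys) ≡ last (x ∷ ys)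
  last-++-∷ [] x ys = refl
  last-++-∷ (_ ∷ []) x ys = refl
  last-++-∷ (_ ∷ x′ ∷ xs) x ys = last-++-∷ (x′ ∷ xs) x ys

  head-++-∷ : ∀ (xs : List A) {x ys zs} → head (xs ++ x ∷ ys) ≡ head (xs ++ x ∷ zs)
  head-++-∷ [] = refl
  head-++-∷ (_ ∷ _) = refl

  head-just : ∀ (xs : List A) {x} → head xs ≡ just x → ∃[ rest ] xs ≡ x ∷ rest
  head-just (x ∷ xs) refl = xs , refl

  last-∷ʳ : ∀ (xs : List A) y → last (xs ∷ʳ y) ≡ just y
  last-∷ʳ xs y = last-++-∷ xs y []

  last-∈ : ∀ (xs : List A) {z} → last xs ≡ just z → z ∈ xs
  last-∈ (x ∷ []) refl = here refl
  last-∈ (x ∷ x′ ∷ xs) eq = there (last-∈ (x′ ∷ xs) eq)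

  Linked-++⁻ʳ : ∀ {R : A → A → Set} (xs : List A) {ys} → Linked R (xs ++ ys) → Linked R ys
  Linked-++⁻ʳ [] l = l
  Linked-++⁻ʳ (x ∷ xs) l = Linked-++⁻ʳ xs (Linked.tail l)

  Linked-middle : ∀ {R : A → A → Set} (xs : List A) {u v ys} → Linked R (xs ++ u ∷ v ∷ ys) → R u v
  Linked-middle xs l = Linked.head (Linked-++⁻ʳ xs l)

  Linked-∷ʳ : ∀ {R : A → A → Set} (xs : List A) {z y} → Linked R xs → last xs ≡ just z → R z y →
    Linked R (xs ∷ʳ y)
  Linked-∷ʳ (x ∷ []) [-] refl r = r ∷ [-]
  Linked-∷ʳ (x ∷ x′ ∷ xs) (r′ ∷ l) eq r = r′ ∷ Linked-∷ʳ (x′ ∷ xs) l eq r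

  Unique-∷ʳ : ∀ (xs : List A) {y} → Unique xs → y ∉ xs → Unique (xs ∷ʳ y)
  Unique-∷ʳ [] _ _ = [] ∷ []
  Unique-∷ʳ (x ∷ xs) (x∉ ∷ u) y∉ = All.tabulate distinct ∷ Unique-∷ʳ xs u (y∉ ∘ there)
    where
      distinct : ∀ {z} → z ∈ xs ∷ʳ _ → x ≢ z
      distinct z∈ with ∈-++⁻ xs z∈
      ... | inj₁ z∈xs = All.lookup x∉ z∈xs
      ... | inj₂ (here refl) = λ x≡y → y∉ (here (sym x≡y))

  ¬Unique-twice : ∀ (xs : List A) {z ys zs} → ¬ Unique (xs ++ z ∷ ys ++ z ∷ zs)
  ¬Unique-twice [] {ys = ys} (z∉ ∷ _) = All.lookup z∉ (∈-++⁺ʳ ys (here refl)) refl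
  ¬Unique-twice (x ∷ xs) (_ ∷ u) = ¬Unique-twice xs u

  first-crossing : ∀ {P : A → Set} → Decidable P → ∀ {x xs y} → P x → ¬ P y → y ∈ x ∷ xs →
    ∃[ pre ] ∃[ u ] ∃[ v ] ∃[ post ] x ∷ xs ≡ pre ++ u ∷ v ∷ post × P u × ¬ P v
  first-crossing P? px ¬py (here refl) = contradiction px ¬py
  first-crossing P? {x} {x′ ∷ xs} px ¬py (there y∈) with P? x′
  ... | no ¬px′ = [] , x , x′ , xs , refl , px , ¬px′
  ... | yes px′ with first-crossing P? px′ ¬py y∈
  ...   | pre , u , v , post , eq , pu , ¬pv = x ∷ pre , u , v , post , cong (x ∷_) eq , pu , ¬pv

module _ {A : Set} where

  position : ∀ {y : A} (q : List A) → y ∈ q →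
    head q ≡ just y ⊎ last q ≡ just y ⊎ ∃[ pre ] ∃[ a ] ∃[ b ] ∃[ post ] q ≡ pre ++ a ∷ y ∷ b ∷ post
  position (x ∷ q) (here refl) = inj₁ refl
  position (x ∷ y ∷ []) (there (here refl)) = inj₂ (inj₁ refl)
  position (x ∷ y ∷ b ∷ post) (there (here refl)) = inj₂ (inj₂ ([] , x , b , post , refl))
  position (x ∷ q) (there y∈) with position q y∈
  ... | inj₁ head≡ with q | head≡
  ...   | y ∷ [] | refl = inj₂ (inj₁ refl)
  ...   | y ∷ b ∷ post | refl = inj₂ (inj₂ ([] , x , b , post , refl))
  position (x ∷ q) (there y∈) | inj₂ (inj₁ last≡) with q | last≡
  ...   | y ∷ q′ | eq = inj₂ (inj₁ eq)
  position (x ∷ q) (there y∈) | inj₂ (inj₂ (pre , a , b , post , eq)) =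
    inj₂ (inj₂ (x ∷ pre , a , b , post , cong (x ∷_) eq))

  last-two : ∀ (x x′ : A) p {z} → last (x ∷ x′ ∷ p) ≡ just z →
    ∃[ pre ] ∃[ c ] x ∷ x′ ∷ p ≡ pre ++ c ∷ z ∷ []
  last-two x x′ [] refl = [] , x , refl
  last-two x x′ (x″ ∷ p) last≡ with last-two x′ x″ p last≡
  ... | pre , c , eq = x ∷ pre , c , cong (x ∷_) eq

  split-last-two : ∀ (p : List A) {y z} → head p ≡ just y → last p ≡ just z → y ≢ z →
    ∃[ pre ] ∃[ c ] p ≡ pre ++ c ∷ z ∷ []
  split-last-two (x ∷ []) refl refl y≢z = contradiction refl y≢z
  split-last-two (x ∷ x′ ∷ p) _ last≡ _ = last-two x x′ p last≡

data Walk {n} (S : VSet n) (E : EdgeRel n) : Fin n → Fin n → ℕ → Set where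
  nil  : ∀ {u} → S u ≡ true → Walk S E u u 0
  cons : ∀ {u v w k} → S u ≡ true → E u v ≡ true → Walk S E v w k → Walk S E u w (suc k)

module _ {n} {S : VSet n} {E : EdgeRel n} where

  vertices : ∀ {u w k} → Walk S E u w k → List (Fin n)
  vertices (nil {u} _) = u ∷ []
  vertices (cons {u} _ _ ω) = u ∷ vertices ω

  start∈ : ∀ {u w k} → Walk S E u w k → S u ≡ true
  start∈ (nil s) = s
  start∈ (cons s _ _) = s

  end∈ : ∀ {u w k} → Walk S E u w k → S w ≡ true
  end∈ (nil s) = s
  end∈ (cons _ _ ω) = end∈ ω

  _++ʷ_ : ∀ {u v w a b} → Walk S E u v a → Walk S E v w b → Walk S E u w (a + b)
  nil _ ++ʷ ω′ = ω′
  cons s e ω ++ʷ ω′ = cons s e (ω ++ʷ ω′)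

  snocʷ : ∀ {u v w k} → Walk S E u v k → E v w ≡ true → S w ≡ true → Walk S E u w (suc k)
  snocʷ (nil s) e s′ = cons s e (nil s′)
  snocʷ (cons s e ω) e′ s′ = cons s e (snocʷ ω e′ s′)

  unsnocʷ : ∀ {u v k} → Walk S E u v (suc k) →
    ∃[ w ] Walk S E u w k × E w v ≡ true × S v ≡ true
  unsnocʷ (cons s e (nil s′)) = _ , nil s , e , s′
  unsnocʷ (cons s e (cons s′ e′ ω)) with unsnocʷ (cons s′ e′ ω)
  ... | w , ω′ , e″ , sv = w , cons s e ω′ , e″ , sv

  reverseʷ : (∀ a b → E a b ≡ E b a) → ∀ {u w k} → Walk S E u w k → Walk S E w u k
  reverseʷ E-sym (nil s) = nil s
  reverseʷ E-sym (cons {u} {v} s e ω) = snocʷ (reverseʷ E-sym ω) (trans (E-sym v u) e) s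

  vertices-head : ∀ {u w k} (ω : Walk S E u w k) → head (vertices ω) ≡ just u
  vertices-head (nil _) = refl
  vertices-head (cons _ _ _) = refl

  vertices-last : ∀ {u w k} (ω : Walk S E u w k) → last (vertices ω) ≡ just w
  vertices-last (nil _) = refl
  vertices-last (cons _ _ (nil _)) = refl
  vertices-last (cons _ _ (cons s e ω)) = vertices-last (cons s e ω)

  vertices-length : ∀ {u w k} (ω : Walk S E u w k) → length (vertices ω) ≡ suc k
  vertices-length (nil _) = refl
  vertices-length (cons _ _ ω) = cong suc (vertices-length ω)

  vertices-isWalk : ∀ {u w k} (ω : Walk S E u w k) → IsWalk S E (vertices ω)
  vertices-isWalk ω = all ω , linked ω
    where
      all : ∀ {u w k} (ω : Walk S E u w k) → All (λ v → S v ≡ true) (vertices ω)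
      all (nil s) = s ∷ []
      all (cons s _ ω) = s ∷ all ω
      linked : ∀ {u w k} (ω : Walk S E u w k) → Linked (λ a b → E a b ≡ true) (vertices ω)
      linked (nil _) = [-]
      linked (cons _ e (nil _)) = e ∷ [-]
      linked (cons _ e (cons s′ e′ ω)) = e ∷ linked (cons s′ e′ ω)

  toWalk : ∀ (p : List (Fin n)) {u w} → IsWalk S E p → Ends p u w → Walk S E u w (length p ∸ 1)
  toWalk (x ∷ []) (s ∷ [] , [-]) (refl , refl) = nil s
  toWalk (x ∷ y ∷ p) (s ∷ ss , e ∷ l) (refl , lst) = cons s e (toWalk (y ∷ p) (ss , l) (refl , lst))

  walkFrom : ∀ {v w k} (ω : Walk S E v w k) {u} → u ∈ vertices ω →
    ∃[ k′ ] k′ ≤ k × Σ (Walk S E u w k′) λ ω′ → ∃[ pre ] vertices ω ≡ pre ++ vertices ω′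
  walkFrom (nil s) (here refl) = 0 , z≤n , nil s , [] , refl
  walkFrom (cons s e ω) (here refl) = _ , ≤-refl , cons s e ω , [] , refl
  walkFrom (cons {v} s e ω) (there u∈) with walkFrom ω u∈
  ... | k′ , k′≤ , ω′ , pre , eq = k′ , m≤n⇒m≤1+n k′≤ , ω′ , v ∷ pre , cong (v ∷_) eq

  shortcut : ∀ {u w k} (ω : Walk S E u w k) →
    ∃[ k′ ] k′ ≤ k × Σ (Walk S E u w k′) (Unique ∘ vertices)
  shortcut (nil s) = 0 , z≤n , nil s , [] ∷ []
  shortcut (cons {u} s e ω) with shortcut ω
  ... | k₁ , k₁≤ , ω₁ , u₁ with DecMembership._∈?_ _≟_ u (vertices ω₁)
  ...   | yes u∈ with walkFrom ω₁ u∈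
  ...     | k₂ , k₂≤ , ω₂ , pre , eq =
    k₂ , m≤n⇒m≤1+n (≤-trans k₂≤ k₁≤) , ω₂ , Unique-++⁻ʳ pre (subst Unique eq u₁)
  shortcut (cons {u} s e ω) | k₁ , k₁≤ , ω₁ , u₁ | no u∉ =
    suc k₁ , s≤s k₁≤ , cons s e ω₁ , ¬Any⇒All¬ (vertices ω₁) u∉ ∷ u₁

  walk⇒path : ∀ {u w k} → Walk S E u w k → ∃[ p ] IsPath S E p × Ends p u w
  walk⇒path ω with shortcut ω
  ... | _ , _ , ω′ , u′ = vertices ω′ , (vertices-isWalk ω′ , u′) , vertices-head ω′ , vertices-last ω′

  shortcut-length< : ∀ {u w k} (ω : Walk S E u w k) → ∃[ k′ ] k′ ≤ k × k′ < n × Walk S E u w k′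
  shortcut-length< ω with shortcut ω
  ... | k′ , k′≤ , ω′ , u′ =
    k′ , k′≤ , subst (_≤ n) (vertices-length ω′) (unique-length≤ u′) , ω′

IsPath⇒allV : ∀ {n} {S : VSet n} {E : EdgeRel n} {p} → IsPath S E p → IsPath allV E p
IsPath⇒allV ((in-S , linked) , uniq) = (All.map (λ _ → refl) in-S , linked) , uniq

mapʷ : ∀ {n} {S S′ : VSet n} {E E′ : EdgeRel n} →
  (∀ {v} → S v ≡ true → S′ v ≡ true) → (∀ {a b} → E a b ≡ true → E′ a b ≡ true) →
  ∀ {u w k} → Walk S E u w k → Walk S′ E′ u w k
mapʷ fS fE (nil s) = nil (fS s)
mapʷ fS fE (cons s e ω) = cons (fS s) (fE e) (mapʷ fS fE ω)

Connected⇒walk : ∀ {n} {S : VSet n} {E : EdgeRel n} → Connected S E →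
  ∀ {u v} → S u ≡ true → S v ≡ true → ∃[ k ] Walk S E u v k
Connected⇒walk connected {u} {v} su sv with connected u v su sv
... | p , (isWalk , _) , ends = _ , toWalk p isWalk ends

walk-closed : ∀ {n} {S : VSet n} {E : EdgeRel n} (Z : Fin n → Set) →
  (∀ {t t′} → Z t → E t t′ ≡ true → Z t′) →
  ∀ {u w k} → Walk S E u w k → Z u → Z w
walk-closed Z closed (nil _) z = z
walk-closed Z closed (cons _ e ω) z = walk-closed Z closed ω (closed z e)

any-allFin⁻ : ∀ {n} (p : Fin n → Bool) → any p (allFin n) ≡ true → ∃[ i ] p i ≡ true
any-allFin⁻ p eq with satisfied (any⁻ p (allFin _) (Equivalence.from T-≡ eq))
... | i , pi = i , Equivalence.to T-≡ pi

any-allFin⁺ : ∀ {n} (p : Fin n → Bool) i → p i ≡ true → any p (allFin n) ≡ true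
any-allFin⁺ p i eq =
  Equivalence.to T-≡ (any⁺ p (Any.map (λ { refl → Equivalence.from T-≡ eq }) (∈-allFin i)))

firstUpTo≡just : ∀ (P : ℕ → Bool) b from m → from ≤ m → m ≤ b + from → P m ≡ true →
  (∀ j → from ≤ j → j < m → P j ≡ false) → firstUpTo P from b ≡ just m
firstUpTo≡just P zero from m from≤m m≤ pm below with ≤-antisym from≤m m≤
... | refl rewrite pm = refl
firstUpTo≡just P (suc b) from m from≤m m≤ pm below with P from in eq | m≤n⇒m<n∨m≡n from≤m
... | true | inj₂ refl = refl
... | true | inj₁ from<m = contradiction (trans (sym eq) (below from ≤-refl from<m)) true≢false
... | false | inj₂ refl = contradiction (trans (sym pm) eq) true≢false
... | false | inj₁ from<m =
  firstUpTo≡just P b (suc from) m from<m (subst (m ≤_) (sym (+-suc b from)) m≤) pm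
    (λ j from<j → below j (<⇒≤ from<j))

module _ {n} {S : VSet n} {E : EdgeRel n} where

  walk⇒reach : ∀ k {u v k′} → Walk S E u v k′ → k′ ≤ k → reach S E k u v ≡ true
  walk⇒reach zero (nil {u} s) z≤n rewrite s | ==-refl u = refl
  walk⇒reach (suc k) {u} {v} ω k′≤ with m≤n⇒m<n∨m≡n k′≤
  ... | inj₁ (s≤s k′≤k) rewrite walk⇒reach k ω k′≤k = refl
  ... | inj₂ refl with unsnocʷ ω
  ...   | w , ω′ , e , sv rewrite sv =
    trans (cong (reach S E k u v ∨_) (any-allFin⁺ (λ w → reach S E k u w ∧ E w v) w
      (∧-true (walk⇒reach k ω′ ≤-refl) e))) (∨-zeroʳ _)

  reach⇒walk : ∀ k {u v} → reach S E k u v ≡ true → ∃[ k′ ] k′ ≤ k × Walk S E u v k′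
  reach⇒walk zero {u} {v} eq with ==⇒≡ {u = u} {v} (∧-trueʳ {S u} eq)
  ... | refl = 0 , z≤n , nil (∧-trueˡ eq)
  reach⇒walk (suc k) {u} {v} eq with ∨-true⁻ {reach S E k u v} eq
  ... | inj₁ r with reach⇒walk k r
  ...   | k′ , k′≤ , ω = k′ , m≤n⇒m≤1+n k′≤ , ω
  reach⇒walk (suc k) {u} {v} eq | inj₂ r
    with any-allFin⁻ (λ w → reach S E k u w ∧ E w v) (∧-trueʳ {S v} r)
  ... | w , q with reach⇒walk k (∧-trueˡ q)
  ...   | k′ , k′≤ , ω = suc k′ , s≤s k′≤ , snocʷ ω (∧-trueʳ {reach S E k u w} q) (∧-trueˡ r)

  IsDistance : Fin n → Fin n → ℕ → Set
  IsDistance u v m = Walk S E u v m × (∀ {k} → Walk S E u v k → m ≤ k)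

  -- reach S E k u v says "there is a walk of length at most k", so a walk
  -- is shortest as soon as reach fails one step below its length
  distance-from-walk : ∀ {u v k} → Walk S E u v k → ∃[ m ] IsDistance u v m
  distance-from-walk ω = go _ ω ≤-refl
    where
      go : ∀ b {u v k} → Walk S E u v k → k ≤ b → ∃[ m ] IsDistance u v m
      go b {k = zero} ω _ = 0 , ω , λ _ → z≤n
      go (suc b) {u} {v} {suc k} ω (s≤s k≤b) with reach S E k u v in r
      ... | true with reach⇒walk k r
      ...   | k′ , k′≤k , ω′ = go b ω′ (≤-trans k′≤k k≤b)
      go (suc b) {u} {v} {suc k} ω _ | false = suc k , ω , minimal
        where
          minimal : ∀ {j} → Walk S E u v j → suc k ≤ j
          minimal {j} ω′ with suc k ≤? j
          ... | yes k<j = k<j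
          ... | no k≮j = contradiction (trans (sym (walk⇒reach k ω′ (≤-pred (≰⇒> k≮j)))) r) true≢false

  IsDistance⇒dist : ∀ {u v m} → IsDistance u v m → dist S E u v ≡ just m
  IsDistance⇒dist {u} {v} {m} (ω , minimal) =
    firstUpTo≡just (λ j → reach S E j u v) n 0 m z≤n m≤n (walk⇒reach m ω ≤-refl) unreachable
    where
      m≤n : m ≤ n + 0
      m≤n with shortcut-length< ω
      ... | _ , _ , k′<n , ω′ = ≤-trans (minimal ω′) (≤-trans (<⇒≤ k′<n) (m≤m+n n 0))
      unreachable : ∀ j → 0 ≤ j → j < m → reach S E j u v ≡ false
      unreachable j _ j<m with reach S E j u v in r
      ... | false = refl
      ... | true with reach⇒walk j r
      ...   | k′ , k′≤j , ω′ = contradiction (≤-trans (minimal ω′) k′≤j) (<⇒≱ j<m)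

-- The path metric and the Wiener index

module Metric {n} (E : EdgeRel n) (E-sym : ∀ a b → E a b ≡ E b a)
  (connected : ∀ u v → ∃[ k ] Walk allV E u v k) where

  abstract
    distance : ∀ u v → ∃[ m ] IsDistance {S = allV} {E = E} u v m
    distance u v = distance-from-walk (proj₂ (connected u v))

    δ : Fin n → Fin n → ℕ
    δ u v = proj₁ (distance u v)

    δ-walk : ∀ u v → Walk allV E u v (δ u v)
    δ-walk u v = proj₁ (proj₂ (distance u v))

    δ-minimal : ∀ {u v k} → Walk allV E u v k → δ u v ≤ k
    δ-minimal {u} {v} = proj₂ (proj₂ (distance u v))

    dist≡δ : ∀ u v → dist allV E u v ≡ just (δ u v)
    dist≡δ u v = IsDistance⇒dist (proj₂ (distance u v))

  δ-sym : ∀ u v → δ u v ≡ δ v u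
  δ-sym u v = ≤-antisym (δ-minimal (reverseʷ E-sym (δ-walk v u))) (δ-minimal (reverseʷ E-sym (δ-walk u v)))

  δ-self : ∀ u → δ u u ≡ 0
  δ-self u = n≤0⇒n≡0 (δ-minimal (nil {E = E} refl))

  δ≡0⇒≡ : ∀ {u v} → δ u v ≡ 0 → u ≡ v
  δ≡0⇒≡ {u} {v} = go (δ-walk u v)
    where
      go : ∀ {k} → Walk allV E u v k → k ≡ 0 → u ≡ v
      go (nil _) _ = refl

  δ-adjacent : ∀ {u v} → E u v ≡ true → u ≢ v → δ u v ≡ 1
  δ-adjacent {u} {v} e u≢v with δ u v in eq | δ-minimal (cons refl e (nil {E = E} refl))
  ... | zero | _ = contradiction (δ≡0⇒≡ eq) u≢v
  ... | suc zero | _ = refl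
  ... | suc (suc _) | s≤s ()

  δ-triangle : ∀ u v w → δ u w ≤ δ u v + δ v w
  δ-triangle u v w = δ-minimal (δ-walk u v ++ʷ δ-walk v w)

  [_<_]δ : Fin n → Fin n → ℕ
  [ u < v ]δ = if toℕ u <ᵇ toℕ v then δ u v else 0

  wiener : ℕ
  wiener = sum λ u → sum λ v → [ u < v ]δ

  Wiener≡wiener : (H : Graph n) → adj H ≡ E → Wiener H ≡ just wiener
  Wiener≡wiener H refl = Σ∞-finite allV _ _ λ u _ → Σ∞-finite _ _ _ (λ v _ → dist≡δ u v)

  sum-δ≡2·wiener : sum (λ u → sum λ v → δ u v) ≡ wiener + wiener
  sum-δ≡2·wiener = begin
    sum (λ u → sum λ v → δ u v)
      ≡⟨ sum-cong-≗ (λ u → sum-cong-≗ (λ v → sym (split u v))) ⟩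
    sum (λ u → sum λ v → [ u < v ]δ + [ v < u ]δ)
      ≡⟨ sum-cong-≗ (λ u → ∑-distrib-+ (λ v → [ u < v ]δ) (λ v → [ v < u ]δ)) ⟩
    sum (λ u → sum (λ v → [ u < v ]δ) + sum λ v → [ v < u ]δ)
      ≡⟨ ∑-distrib-+ (λ u → sum λ v → [ u < v ]δ) (λ u → sum λ v → [ v < u ]δ) ⟩
    wiener + sum (λ u → sum λ v → [ v < u ]δ)
      ≡⟨ cong (wiener +_) (∑-comm (λ u v → [ v < u ]δ)) ⟩
    wiener + wiener ∎
    where
      open ≡-Reasoning
      <ᵇ-false : ∀ m k → ¬ m < k → (m <ᵇ k) ≡ false
      <ᵇ-false m k m≮k with m <ᵇ k in eq
      ... | false = refl
      ... | true = contradiction (<ᵇ⇒< m k (subst T (sym eq) _)) m≮k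
      <ᵇ-true : ∀ {m k} → m < k → (m <ᵇ k) ≡ true
      <ᵇ-true m<k = Equivalence.to T-≡ (<⇒<ᵇ m<k)
      split : ∀ u v → [ u < v ]δ + [ v < u ]δ ≡ δ u v
      split u v with <-cmp (toℕ u) (toℕ v)
      ... | tri< u<v _ v≮u rewrite <ᵇ-true u<v | <ᵇ-false _ _ v≮u = +-identityʳ _
      ... | tri> u≮v _ v<u rewrite <ᵇ-true v<u | <ᵇ-false _ _ u≮v = δ-sym v u
      ... | tri≈ u≮v u≡v v≮u
        rewrite <ᵇ-false _ _ u≮v | <ᵇ-false _ _ v≮u | toℕ-injective u≡v = sym (δ-self v)

-- Hanging sets

∁ : ∀ {n} → VSet n → VSet n
∁ S z = not (S z)

record HangsAt {n} (E : EdgeRel n) (S : VSet n) (h : Fin n) : Set where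
  field
    anchor∉ : S h ≡ false
    exit : ∀ {s z} → S s ≡ true → S z ≡ false → E s z ≡ true → z ≡ h

module Hanging {n} {E : EdgeRel n} {S : VSet n} {h : Fin n} (hangs : HangsAt E S h) where

  open HangsAt hangs

  Exit : Fin n → Fin n → ℕ → Set
  Exit s w k = ∃[ a ] ∃[ k₁ ] ∃[ k₂ ]
    Walk S E s a k₁ × E a h ≡ true × Walk allV E h w k₂ × suc (k₁ + k₂) ≡ k

  stay-or-exit : ∀ {s w k} → Walk allV E s w k → S s ≡ true → Walk S E s w k ⊎ Exit s w k
  stay-or-exit (nil _) s∈ = inj₁ (nil s∈)
  stay-or-exit (cons {v = v} _ e ω) s∈ with S v in v∈
  ... | false with exit s∈ v∈ e
  ...   | refl = inj₂ (_ , 0 , _ , nil s∈ , e , ω , refl)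
  stay-or-exit (cons {v = v} _ e ω) s∈ | true with stay-or-exit ω v∈
  ...   | inj₁ ω′ = inj₁ (cons s∈ e ω′)
  ...   | inj₂ (a , k₁ , k₂ , ω₁ , ea , ω₂ , eq) =
    inj₂ (a , suc k₁ , k₂ , cons s∈ e ω₁ , ea , ω₂ , cong suc eq)

  first-exit : ∀ {s w k} → Walk allV E s w k → S s ≡ true → S w ≡ false → Exit s w k
  first-exit ω s∈ w∉ with stay-or-exit ω s∈
  ... | inj₂ x = x
  ... | inj₁ ω′ = contradiction (trans (sym (end∈ ω′)) w∉) true≢false

  entry : Fin n → Fin n
  entry x = if S x then h else x

  -- a walk that enters S has to come back through h, so the excursion can be dropped
  avoid : (∀ a b → E a b ≡ E b a) → ∀ {x w k} → Walk allV E x w k → S w ≡ false →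
    ∃[ k′ ] k′ ≤ k × Walk (∁ S) E (entry x) w k′
  avoid E-sym (nil {x} _) w∉ rewrite w∉ = 0 , z≤n , nil (cong not w∉)
  avoid E-sym (cons {x} {v} _ e ω) w∉ with S x in x∈ | S v in v∈ | avoid E-sym ω w∉
  ... | false | false | k′ , k′≤ , ω′ = suc k′ , s≤s k′≤ , cons (cong not x∈) e ω′
  ... | true | false | k′ , k′≤ , ω′ rewrite exit x∈ v∈ e = k′ , m≤n⇒m≤1+n k′≤ , ω′
  ... | true | true | k′ , k′≤ , ω′ = k′ , m≤n⇒m≤1+n k′≤ , ω′
  ... | false | true | k′ , k′≤ , ω′ rewrite exit v∈ x∈ (trans (E-sym v x) e) =
    k′ , m≤n⇒m≤1+n k′≤ , ω′

  module Distances (E-sym : ∀ a b → E a b ≡ E b a) (connected : ∀ u v → ∃[ k ] Walk allV E u v k) where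

    open Metric E E-sym connected

    δ-via-anchor : ∀ {s w} → S s ≡ true → S w ≡ false → δ s w ≡ δ s h + δ h w
    δ-via-anchor {s} {w} s∈ w∉ with first-exit (δ-walk s w) s∈ w∉
    ... | a , k₁ , k₂ , ω₁ , ea , ω₂ , eq =
      ≤-antisym (δ-triangle s h w)
        (subst (δ s h + δ h w ≤_) eq
          (+-mono-≤ (δ-minimal (snocʷ (mapʷ (λ _ → refl) (λ e → e) ω₁) ea refl)) (δ-minimal ω₂)))

    avoid-δ : ∀ {u w} → S u ≡ false → S w ≡ false → ∃[ k ] k ≤ δ u w × Walk (∁ S) E u w k
    avoid-δ {u} u∉ w∉ with avoid E-sym (δ-walk u _) w∉
    ... | k , k≤ , ω rewrite u∉ = k , k≤ , ω

    dist-outside : ∀ {u w} → S u ≡ false → S w ≡ false → dist (∁ S) E u w ≡ just (δ u w)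
    dist-outside {u} {w} u∉ w∉ with avoid-δ u∉ w∉
    ... | k , k≤ , ω = IsDistance⇒dist
      (subst (Walk (∁ S) E u w) (≤-antisym k≤ (δ-minimal (forget ω))) ω , δ-minimal ∘ forget)
      where
        forget : ∀ {k} → Walk (∁ S) E u w k → Walk allV E u w k
        forget = mapʷ (λ _ → refl) (λ e → e)

SingleCrossing : ∀ {n} → EdgeRel n → VSet n → Fin n → Fin n → Set
SingleCrossing E C a b = ∀ {x y} → C x ≢ C y → E x y ≡ true → (x ≡ a × y ≡ b) ⊎ (x ≡ b × y ≡ a)

module _ {n} {E : EdgeRel n} {C : VSet n} {a b : Fin n} (single : SingleCrossing E C a b) where

  crossing-back : ∀ {u v u′ v′} → C u ≢ C v → E u v ≡ true → C u′ ≢ C v′ → E u′ v′ ≡ true →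
    C u′ ≡ C v → u′ ≡ v × v′ ≡ u
  crossing-back {u} {v} {u′} {v′} uv e u′v′ e′ same = go (single uv e) (single u′v′ e′)
    where
      go : (u ≡ a × v ≡ b) ⊎ (u ≡ b × v ≡ a) → (u′ ≡ a × v′ ≡ b) ⊎ (u′ ≡ b × v′ ≡ a) →
        u′ ≡ v × v′ ≡ u
      go (inj₁ (refl , refl)) (inj₂ (refl , refl)) = refl , refl
      go (inj₂ (refl , refl)) (inj₁ (refl , refl)) = refl , refl
      go (inj₁ (refl , refl)) (inj₁ (refl , refl)) = contradiction same uv
      go (inj₂ (refl , refl)) (inj₂ (refl , refl)) = contradiction same uv

Unique-after : ∀ {A : Set} {x : A} {ys} pre {u R} → x ∷ ys ≡ pre ++ u ∷ R → Unique ys → Unique R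
Unique-after [] refl uniq = uniq
Unique-after (_ ∷ pre) refl uniq with Unique-++⁻ʳ pre uniq
... | _ ∷ uniq′ = uniq′

-- going around a cycle, one cannot traverse an edge and later traverse it backwards
no-return : ∀ {A : Set} {x₀ : A} xs → Unique (x₀ ∷ xs) → 3 ≤ length (x₀ ∷ xs) →
  ∀ pre {u v post} pre′ {post′} →
  x₀ ∷ xs ∷ʳ x₀ ≡ pre ++ u ∷ v ∷ post → v ∷ post ≡ pre′ ++ v ∷ u ∷ post′ → ⊥
no-return xs (x₀∉ ∷ uniq) _ pre (_ ∷ _) eq refl =
  ¬Unique-twice [] (Unique-after pre eq (Unique-∷ʳ xs uniq λ x₀∈ → All.lookup x₀∉ x₀∈ refl))
no-return xs (x₀∉ ∷ uniq) _ (_ ∷ pre) [] eq refl =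
  ¬Unique-twice pre {ys = _ ∷ []}
    (subst Unique (proj₂ (∷-injective eq)) (Unique-∷ʳ xs uniq λ x₀∈ → All.lookup x₀∉ x₀∈ refl))
no-return [] _ _ [] [] () refl
no-return (_ ∷ []) _ (s≤s (s≤s ())) [] [] refl refl
no-return (_ ∷ _ ∷ _) (x₀∉ ∷ _) _ [] [] refl refl = All.lookup x₀∉ (there (here refl)) refl

cycle-one-side : ∀ {n} {E : EdgeRel n} {C : VSet n} {a b} → SingleCrossing E C a b →
  ∀ {x₀ xs} → IsCycle allV E (x₀ ∷ xs) → All (λ y → C y ≡ C x₀) (x₀ ∷ xs)
cycle-one-side {E = E} {C} single {x₀} {xs} (((_ , linked) , uniq) , 3≤ , _ , _ , refl , last≡ , closing) =
  All.tabulate side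
  where
    Edge = λ s t → E s t ≡ true
    closed : Linked Edge (x₀ ∷ xs ∷ʳ x₀)
    closed = Linked-∷ʳ (x₀ ∷ xs) linked last≡ closing
    same? : Decidable (λ z → C z ≡ C x₀)
    same? z = C z Bool.≟ C x₀
    side : ∀ {y} → y ∈ x₀ ∷ xs → C y ≡ C x₀
    side {y} y∈ with same? y
    ... | yes same = same
    ... | no other with first-crossing same? refl other (∈-++⁺ˡ y∈)
    ...   | pre , u , v , post , eq , u-same , v-other
      with first-crossing (¬? ∘ same?) v-other (λ ¬same → ¬same refl)
             (last-∈ (v ∷ post) (trans (sym (last-++-∷ pre u (v ∷ post)))
                                       (trans (sym (cong last eq)) (last-∷ʳ (x₀ ∷ xs) x₀))))
    ...     | pre′ , u′ , v′ , post′ , eq′ , u′-other , ¬v′-other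
      with crossing-back single
             (λ Cu≡Cv → v-other (trans (sym Cu≡Cv) u-same))
             (Linked-middle pre (subst (Linked Edge) eq closed))
             (λ Cu′≡Cv′ → ¬v′-other λ v′-same → u′-other (trans Cu′≡Cv′ v′-same))
             (Linked-middle pre′
               (subst (Linked Edge) eq′ (Linked.tail (Linked-++⁻ʳ pre (subst (Linked Edge) eq closed)))))
             (trans (Bool.¬-not u′-other) (sym (Bool.¬-not v-other)))
    ...       | refl , refl = ⊥-elim (no-return xs uniq 3≤ pre pre′ eq eq′)

-- Re-attaching a hanging set

rehangAdj : ∀ {n} → Graph n → VSet n → Fin n → Fin n → EdgeRel n
rehangAdj T S h h′ u w =
  if S u then (if S w then adj T u w else adj T u h ∧ (w == h′))
         else (if S w then adj T w h ∧ (u == h′) else adj T u w)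

rehang : ∀ {n} → Graph n → VSet n → Fin n → Fin n → Graph n
rehang T S h h′ = record { adj = rehangAdj T S h h′ ; sym = symmetric ; irrefl = irreflexive }
  where
    symmetric : ∀ u w → rehangAdj T S h h′ u w ≡ rehangAdj T S h h′ w u
    symmetric u w with S u | S w
    ... | true | true = Graph.sym T u w
    ... | true | false = refl
    ... | false | true = refl
    ... | false | false = Graph.sym T u w
    irreflexive : ∀ u → rehangAdj T S h h′ u u ≡ false
    irreflexive u with S u
    ... | true = Graph.irrefl T u
    ... | false = Graph.irrefl T u

module _ {n} (T : Graph n) (S : VSet n) (h h′ : Fin n) where

  rehang-same-side : ∀ {u w} → S u ≡ S w → adj (rehang T S h h′) u w ≡ adj T u w
  rehang-same-side {u} {w} eq with S u | S w
  rehang-same-side refl | true | true = refl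
  rehang-same-side refl | false | false = refl

  rehang-cross : ∀ {s z} → S s ≡ true → S z ≡ false → adj (rehang T S h h′) s z ≡ adj T s h ∧ (z == h′)
  rehang-cross s∈ z∉ rewrite s∈ | z∉ = refl

  rehang-cross⁻ : ∀ {s z} → S s ≡ true → S z ≡ false → adj (rehang T S h h′) s z ≡ true →
    adj T s h ≡ true × z ≡ h′
  rehang-cross⁻ {s} s∈ z∉ e = ∧-trueˡ e′ , ==⇒≡ (∧-trueʳ {adj T s h} e′)
    where e′ = trans (sym (rehang-cross s∈ z∉)) e

IsCycle-transfer : ∀ {n} {E E′ : EdgeRel n} {P : Fin n → Set} →
  (∀ {x y} → P x → P y → E′ x y ≡ true → E x y ≡ true) →
  ∀ {p} → All P p → IsCycle allV E′ p → IsCycle allV E p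
IsCycle-transfer {E = E} {E′} {P} E′⇒E {p} all
  (((in-V , linked) , uniq) , 3≤ , a , b , head≡ , last≡ , closing) =
  ((in-V , transfer all linked) , uniq) , 3≤ , a , b , head≡ , last≡ ,
    E′⇒E (All.lookup all (last-∈ p last≡)) (All.lookup all (head-∈ p head≡)) closing
  where
    transfer : ∀ {q} → All P q → Linked (λ x y → E′ x y ≡ true) q → Linked (λ x y → E x y ≡ true) q
    transfer [] [] = []
    transfer (_ ∷ []) [-] = [-]
    transfer (px ∷ py ∷ ps) (e ∷ l) = E′⇒E px py e ∷ transfer (py ∷ ps) l
    head-∈ : ∀ (q : List (Fin _)) {z} → head q ≡ just z → z ∈ q
    head-∈ (x ∷ q) refl = here refl

leaf∉cycle : ∀ {n} {E : EdgeRel n} → (∀ a b → E a b ≡ E b a) → ∀ {y b} →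
  (∀ {z} → E y z ≡ true → z ≡ b) → ∀ {p} → IsCycle allV E p → y ∉ p
leaf∉cycle {E = E} E-sym {y} {b} leaf {x₀ ∷ x₁ ∷ xs} cycle@((_ , (x₀∉ ∷ _)) , _) y∈
  = All.lookup x₀∉ (here refl) (trans (is-y (here refl)) (sym (is-y (there (here refl)))))
  where
    single : SingleCrossing E (_== y) y b
    single {x} {z} differ e with x == y in x-y | z == y in z-y
    ... | true | true = contradiction refl differ
    ... | false | false = contradiction refl differ
    ... | true | false rewrite ==⇒≡ {u = x} x-y = inj₁ (refl , leaf e)
    ... | false | true rewrite ==⇒≡ {u = z} z-y = inj₂ (leaf (trans (E-sym y x) e) , refl)
    x₀-is-y : (x₀ == y) ≡ true
    x₀-is-y = trans (sym (All.lookup (cycle-one-side single cycle) y∈)) (==-refl y)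
    is-y : ∀ {w} → w ∈ x₀ ∷ x₁ ∷ xs → w ≡ y
    is-y w∈ = ==⇒≡ (trans (All.lookup (cycle-one-side single cycle) w∈) x₀-is-y)
leaf∉cycle _ _ {x₀ ∷ []} (_ , s≤s () , _)
leaf∉cycle _ _ {[]} (_ , () , _)

module _ {n} (T : Graph n) (acyclic : Acyclic allV (adj T)) (S : VSet n) {h h′ : Fin n}
  (h∉ : S h ≡ false) where

  one-sided-cycle : ∀ {c p} → All (λ y → S y ≡ c) p → ¬ IsCycle allV (adj (rehang T S h h′)) p
  one-sided-cycle {p = p} all cycle =
    acyclic p (IsCycle-transfer
      (λ x-side y-side e → trans (sym (rehang-same-side T S h h′ (trans x-side (sym y-side)))) e) all cycle)

  rehang-leaves-acyclic : (∀ {s z} → S s ≡ true → adj T s z ≡ true → z ≡ h) →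
    Acyclic allV (adj (rehang T S h h′))
  rehang-leaves-acyclic leaf p cycle = one-sided-cycle (All.tabulate outside) cycle
    where
      only-h′ : ∀ {s z} → S s ≡ true → adj (rehang T S h h′) s z ≡ true → z ≡ h′
      only-h′ {s} {z} s∈ e with bool-cases (S z)
      ... | inj₂ z∉ = proj₂ (rehang-cross⁻ T S h h′ s∈ z∉ e)
      ... | inj₁ z∈ = contradiction (trans (sym z∈) (trans (cong S z≡h) h∉)) true≢false
        where z≡h = leaf s∈ (trans (sym (rehang-same-side T S h h′ (trans s∈ (sym z∈)))) e)
      outside : ∀ {y} → y ∈ p → S y ≡ false
      outside {y} y∈ with S y in y∈S
      ... | false = refl
      ... | true = contradiction y∈ (leaf∉cycle (Graph.sym (rehang T S h h′)) (only-h′ y∈S) cycle)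

  rehang-branch-acyclic : ∀ {a} → (∀ {s} → S s ≡ true → adj T s h ≡ true → s ≡ a) →
    Acyclic allV (adj (rehang T S h h′))
  rehang-branch-acyclic {a} attached-at-a [] (_ , () , _)
  rehang-branch-acyclic {a} attached-at-a (x₀ ∷ xs) cycle = one-sided-cycle (cycle-one-side single cycle) cycle
    where
      single : SingleCrossing (adj (rehang T S h h′)) S a h′
      single {x} {z} differ e with bool-cases (S x) | bool-cases (S z)
      ... | inj₁ x∈ | inj₁ z∈ = contradiction (trans x∈ (sym z∈)) differ
      ... | inj₂ x∉ | inj₂ z∉ = contradiction (trans x∉ (sym z∉)) differ
      ... | inj₁ x∈ | inj₂ z∉ with rehang-cross⁻ T S h h′ x∈ z∉ e
      ...   | xh , refl = inj₁ (attached-at-a x∈ xh , refl)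
      single {x} {z} differ e | inj₂ x∉ | inj₁ z∈
        with rehang-cross⁻ T S h h′ z∈ x∉ (trans (Graph.sym (rehang T S h h′) z x) e)
      ...   | zh , refl = inj₂ (refl , attached-at-a z∈ zh)

crossTerm : ∀ {n} → VSet n → (Fin n → ℕ) → Fin n → Fin n → ℕ
crossTerm S f u w = if S u then (if S w then 0 else f w) else (if S w then f u else 0)

sum-crossTerm : ∀ {n} (S : VSet n) (f : Fin n → ℕ) →
  sum (λ u → sum (crossTerm S f u)) ≡ sumOutside S f * size S + sumOutside S f * size S
sum-crossTerm S f = begin
  sum (λ u → sum (crossTerm S f u))
    ≡⟨ sum-cong-≗ row ⟩
  sum (λ u → sumOutside S f * 𝟙[ S u ] + outside u * size S)
    ≡⟨ ∑-distrib-+ (λ u → sumOutside S f * 𝟙[ S u ]) (λ u → outside u * size S) ⟩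
  sum (λ u → sumOutside S f * 𝟙[ S u ]) + sum (λ u → outside u * size S)
    ≡⟨ cong₂ _+_ (sym (*-distribˡ-sum (sumOutside S f) (λ u → 𝟙[ S u ]))) (begin
         sum (λ u → outside u * size S)   ≡⟨ sum-cong-≗ (λ u → *-comm (outside u) (size S)) ⟩
         sum (λ u → size S * outside u)   ≡⟨ sym (*-distribˡ-sum (size S) outside) ⟩
         size S * sumOutside S f          ≡⟨ *-comm (size S) _ ⟩
         sumOutside S f * size S          ∎) ⟩
  sumOutside S f * size S + sumOutside S f * size S ∎
  where
    open ≡-Reasoning
    outside : Fin _ → ℕ
    outside u = if S u then 0 else f u
    row : ∀ u → sum (crossTerm S f u) ≡ sumOutside S f * 𝟙[ S u ] + outside u * size S
    row u with S u
    ... | true = trans (sym (*-identityʳ _)) (sym (+-identityʳ _))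
    ... | false = trans (sumInside-const S (f u)) (sym (cong (_+ f u * size S) (*-zeroʳ (sumOutside S f))))

-- Distances inside S and inside its complement do not grow, and for s ∈ S, w ∉ S the distance
-- δ s h + δ h w becomes at most δ s h + δ h′ w. Summing over ordered pairs, 2 W(T′) − 2 W(T) is at
-- most 2 |S| (Σ_{w∉S} δ h′ w − Σ_{w∉S} δ h w), and W(T) ≤ W(T′) as T is a MAD tree.
module Rehang {n} (G T : Graph n) (mad : IsMAD G T) {S : VSet n} {h h′ : Fin n}
  (hangs : HangsAt (adj T) S h) (h′∉ : S h′ ≡ false)
  (G-edge : ∀ {s} → S s ≡ true → adj T s h ≡ true → adj G s h′ ≡ true)
  (acyclic′ : Acyclic allV (adj (rehang T S h h′))) where

  open HangsAt hangs
  open Hanging hangs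

  connected : ∀ u v → ∃[ k ] Walk allV (adj T) u v k
  connected u v = Connected⇒walk (proj₁ (proj₂ (proj₁ mad))) refl refl

  open Metric (adj T) (Graph.sym T) connected
  open Distances (Graph.sym T) connected

  T′ : Graph n
  T′ = rehang T S h h′

  inside⇒T′ : ∀ {u w k} → Walk S (adj T) u w k → Walk allV (adj T′) u w k
  inside⇒T′ (nil _) = nil refl
  inside⇒T′ (cons s e ω) =
    cons refl (trans (rehang-same-side T S h h′ (trans s (sym (start∈ ω)))) e) (inside⇒T′ ω)

  outside⇒T′ : ∀ {u w k} → Walk (∁ S) (adj T) u w k → Walk allV (adj T′) u w k
  outside⇒T′ (nil _) = nil refl
  outside⇒T′ (cons s e ω) =
    cons refl (trans (rehang-same-side T S h h′ (trans (not-true s) (sym (not-true (start∈ ω))))) e) (outside⇒T′ ω)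

  leave : ∀ {s w k} → Exit s w k →
    ∃[ k₁ ] ∃[ k₂ ] Walk allV (adj T′) s h′ k₁ × Walk allV (adj T) h w k₂ × k₁ + k₂ ≡ k
  leave (a , k₁ , k₂ , ω₁ , ah , ω₂ , refl) =
    suc k₁ , k₂ ,
    snocʷ (inside⇒T′ ω₁) (trans (rehang-cross T S h h′ (end∈ ω₁) h′∉) (∧-true ah (==-refl h′))) refl ,
    ω₂ , refl

  to-h′ : ∀ u → ∃[ k ] Walk allV (adj T′) u h′ k
  to-h′ u with bool-cases (S u)
  ... | inj₁ u∈ with leave (first-exit (δ-walk u h) u∈ anchor∉)
  ...   | k , _ , ω , _ = k , ω
  to-h′ u | inj₂ u∉ with avoid-δ u∉ h′∉
  ...   | k , _ , ω = k , outside⇒T′ ω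

  connected′ : ∀ u v → ∃[ k ] Walk allV (adj T′) u v k
  connected′ u v = _ , proj₂ (to-h′ u) ++ʷ reverseʷ (Graph.sym T′) (proj₂ (to-h′ v))

  T⊆G : ∀ {u v} → adj T u v ≡ true → adj G u v ≡ true
  T⊆G = proj₁ (proj₁ mad) _ _

  spanning′ : IsSpanningTree G T′
  spanning′ = subgraph , (λ u v _ _ → walk⇒path (proj₂ (connected′ u v))) , acyclic′
    where
      subgraph : ∀ u v → adj T′ u v ≡ true → adj G u v ≡ true
      subgraph u v e with bool-cases (S u) | bool-cases (S v)
      ... | inj₁ u∈ | inj₁ v∈ = T⊆G (trans (sym (rehang-same-side T S h h′ (trans u∈ (sym v∈)))) e)
      ... | inj₂ u∉ | inj₂ v∉ = T⊆G (trans (sym (rehang-same-side T S h h′ (trans u∉ (sym v∉)))) e)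
      ... | inj₁ u∈ | inj₂ v∉ with rehang-cross⁻ T S h h′ u∈ v∉ e
      ...   | uh , refl = G-edge u∈ uh
      subgraph u v e | inj₂ u∉ | inj₁ v∈ with rehang-cross⁻ T S h h′ v∈ u∉ (trans (Graph.sym T′ v u) e)
      ...   | vh , refl = trans (Graph.sym G u v) (G-edge v∈ vh)

  module Rehanged = Metric (adj T′) (Graph.sym T′) connected′

  inside-bound : ∀ {s s′} → S s ≡ true → S s′ ≡ true → Rehanged.δ s s′ ≤ δ s s′
  inside-bound {s} {s′} s∈ s′∈ with stay-or-exit (δ-walk s s′) s∈
  ... | inj₁ ω = Rehanged.δ-minimal (inside⇒T′ ω)
  ... | inj₂ x with leave x
  ...   | k₁ , k₂ , ω₁ , ω₂ , eq with leave (first-exit (reverseʷ (Graph.sym T) ω₂) s′∈ anchor∉)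
  ...     | k₃ , k₄ , ω₃ , _ , eq′ = begin
    Rehanged.δ s s′ ≤⟨ Rehanged.δ-minimal (ω₁ ++ʷ reverseʷ (Graph.sym T′) ω₃) ⟩
    k₁ + k₃         ≤⟨ +-monoʳ-≤ k₁ (subst (k₃ ≤_) eq′ (m≤m+n k₃ k₄)) ⟩
    k₁ + k₂         ≡⟨ eq ⟩
    δ s s′          ∎
    where open ≤-Reasoning

  cross-bound : ∀ {s w} → S s ≡ true → S w ≡ false → Rehanged.δ s w ≤ δ s h + δ h′ w
  cross-bound {s} {w} s∈ w∉ with leave (first-exit (δ-walk s h) s∈ anchor∉) | avoid-δ h′∉ w∉
  ... | k₁ , k₂ , ω₁ , _ , eq | k , k≤ , ω = begin
    Rehanged.δ s w  ≤⟨ Rehanged.δ-minimal (ω₁ ++ʷ outside⇒T′ ω) ⟩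
    k₁ + k          ≤⟨ +-mono-≤ (subst (k₁ ≤_) eq (m≤m+n k₁ k₂)) k≤ ⟩
    δ s h + δ h′ w  ∎
    where open ≤-Reasoning

  outside-bound : ∀ {u w} → S u ≡ false → S w ≡ false → Rehanged.δ u w ≤ δ u w
  outside-bound u∉ w∉ with avoid-δ u∉ w∉
  ... | k , k≤ , ω = ≤-trans (Rehanged.δ-minimal (outside⇒T′ ω)) k≤

  core : Fin n → Fin n → ℕ
  core u w = if S u then (if S w then δ u w else δ u h) else (if S w then δ w h else δ u w)

  δ≡core+cross : ∀ u w → δ u w ≡ core u w + crossTerm S (δ h) u w
  δ≡core+cross u w with S u in u∈ | S w in w∈
  ... | true | true = sym (+-identityʳ _)
  ... | true | false = δ-via-anchor u∈ w∈
  ... | false | true = trans (δ-sym u w) (δ-via-anchor w∈ u∈)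
  ... | false | false = sym (+-identityʳ _)

  δ′≤core+cross : ∀ u w → Rehanged.δ u w ≤ core u w + crossTerm S (δ h′) u w
  δ′≤core+cross u w with S u in u∈ | S w in w∈
  ... | true | true = ≤-trans (inside-bound u∈ w∈) (≤-reflexive (sym (+-identityʳ _)))
  ... | true | false = cross-bound u∈ w∈
  ... | false | true = subst (_≤ δ w h + δ h′ u) (Rehanged.δ-sym w u) (cross-bound w∈ u∈)
  ... | false | false = ≤-trans (outside-bound u∈ w∈) (≤-reflexive (sym (+-identityʳ _)))

  sum² : (Fin n → Fin n → ℕ) → ℕ
  sum² f = sum λ u → sum (f u)

  sum²-+ : ∀ f g → sum² (λ u w → f u w + g u w) ≡ sum² f + sum² g
  sum²-+ f g = trans (sum-cong-≗ λ u → ∑-distrib-+ (f u) (g u)) (∑-distrib-+ (sum ∘ f) (sum ∘ g))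

  wiener≤ : wiener ≤ Rehanged.wiener
  wiener≤ = subst₂ _≤∞_ (Wiener≡wiener T refl) (Rehanged.Wiener≡wiener T′ refl) (proj₂ mad T′ spanning′)

  cross≤ : sum² (crossTerm S (δ h)) ≤ sum² (crossTerm S (δ h′))
  cross≤ = +-cancelˡ-≤ (sum² core) _ _ (begin
    sum² core + sum² (crossTerm S (δ h))   ≡⟨ sym (sum²-+ core (crossTerm S (δ h))) ⟩
    sum² (λ u w → core u w + crossTerm S (δ h) u w) ≡⟨ sym (sum-cong-≗ λ u → sum-cong-≗ (δ≡core+cross u)) ⟩
    sum² δ                                 ≡⟨ sum-δ≡2·wiener ⟩
    wiener + wiener                        ≤⟨ +-mono-≤ wiener≤ wiener≤ ⟩
    Rehanged.wiener + Rehanged.wiener      ≡⟨ sym Rehanged.sum-δ≡2·wiener ⟩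
    sum² Rehanged.δ                        ≤⟨ sum-mono-≤ (λ u → sum-mono-≤ (δ′≤core+cross u)) ⟩
    sum² (λ u w → core u w + crossTerm S (δ h′) u w) ≡⟨ sum²-+ core (crossTerm S (δ h′)) ⟩
    sum² core + sum² (crossTerm S (δ h′))  ∎)
    where open ≤-Reasoning

  sumOutside-anchor≤ : ∀ {s₀} → S s₀ ≡ true → sumOutside S (δ h) ≤ sumOutside S (δ h′)
  sumOutside-anchor≤ s₀∈ = *-cancelʳ-≤ _ _ (size S) {{>-nonZero (0<size S s₀∈)}}
    (m+m≤n+n⇒m≤n (subst₂ _≤_ (sum-crossTerm S (δ h)) (sum-crossTerm S (δ h′)) cross≤))
    where
      m+m≤n+n⇒m≤n : ∀ {m n} → m + m ≤ n + n → m ≤ n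
      m+m≤n+n⇒m≤n {m} {n} le with m ≤? n
      ... | yes m≤n = m≤n
      ... | no m≰n = contradiction le (<⇒≱ (+-mono-< (≰⇒> m≰n) (≰⇒> m≰n)))

module _ {n} (H : Graph n) where

  2≤deg : ∀ {v a b} → adj H v a ≡ true → adj H v b ≡ true → a ≢ b → 2 ≤ deg H v
  2≤deg {v} {a} {b} va vb a≢b = begin
    2                                        ≡⟨ cong₂ (λ x y → 𝟙[ x ] + 𝟙[ y ]) (sym va) (sym vb) ⟩
    𝟙[ adj H v a ] + 𝟙[ adj H v b ]          ≤⟨ two-terms≤sum (λ w → 𝟙[ adj H v w ]) a≢b ⟩
    size (adj H v)                           ≡⟨ sym (count≡size (adj H v)) ⟩
    deg H v                                  ∎
    where open ≤-Reasoning

  deg<2⇒same-neighbour : ∀ {v a b} → ¬ 2 ≤ deg H v → adj H v a ≡ true → adj H v b ≡ true → a ≡ b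
  deg<2⇒same-neighbour {a = a} {b} deg<2 va vb with a ≟ b
  ... | yes a≡b = a≡b
  ... | no a≢b = contradiction (2≤deg va vb a≢b) deg<2

  deg≡1⇒sole-neighbour : ∀ {v} → deg H v ≡ 1 →
    ∃[ x ] adj H v x ≡ true × (∀ {w} → adj H v w ≡ true → w ≡ x)
  deg≡1⇒sole-neighbour {v} deg≡1
    with 0<sum⇒term (λ w → 𝟙[ adj H v w ]) (subst (0 <_) (trans (sym deg≡1) (count≡size (adj H v))) (s≤s z≤n))
  ... | x , 0<𝟙 with adj H v x in vx
  ...   | true = x , vx , λ vw → deg<2⇒same-neighbour deg≮2 vw vx
    where
      deg≮2 : ¬ 2 ≤ deg H v
      deg≮2 2≤ = contradiction (subst (2 ≤_) deg≡1 2≤) (λ { (s≤s ()) })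

  interior⇒2≤deg : ∀ {q} → IsPath allV (adj H) q → ∀ pre {a y b post} →
    q ≡ pre ++ a ∷ y ∷ b ∷ post → 2 ≤ deg H y
  interior⇒2≤deg ((_ , linked) , uniq) pre {a} {y} {b} {post} refl =
    2≤deg (trans (Graph.sym H y a) (Linked-middle pre linked))
          (Linked-middle (pre ∷ʳ a) (subst (Linked _) (sym (∷ʳ-++ pre a (y ∷ b ∷ post))) linked))
          a≢b
    where
      a≢b : a ≢ b
      a≢b with Unique-++⁻ʳ pre uniq
      ... | a∉ ∷ _ = All.lookup a∉ (there (here refl))

  inner⇒2≤deg : ∀ {q y} → IsPath allV (adj H) q → y ∈ q → head q ≢ just y → last q ≢ just y →
    2 ≤ deg H y
  inner⇒2≤deg {q} path y∈ not-head not-last with position q y∈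
  ... | inj₁ head≡ = contradiction head≡ not-head
  ... | inj₂ (inj₁ last≡) = contradiction last≡ not-last
  ... | inj₂ (inj₂ (pre , _ , _ , _ , eq)) = interior⇒2≤deg path pre eq

-- Branches of a tree

module Branch {n} (T : Graph n) (acyclic : Acyclic allV (adj T)) {c a : Fin n} (ca : adj T c a ≡ true) where

  removed : Fin n → Fin n → Bool
  removed u w = ((u == c) ∧ (w == a)) ∨ ((u == a) ∧ (w == c))

  cut : EdgeRel n
  cut u w = adj T u w ∧ not (removed u w)

  S : VSet n
  S w = reach allV cut n a w

  walk⇒S : ∀ {w k} → Walk allV cut a w k → S w ≡ true
  walk⇒S ω with shortcut-length< ω
  ... | k′ , _ , k′<n , ω′ = walk⇒reach n ω′ (<⇒≤ k′<n)

  a∈S : S a ≡ true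
  a∈S = walk⇒S (nil refl)

  removed⇒ : ∀ {u w} → removed u w ≡ true → (u ≡ c × w ≡ a) ⊎ (u ≡ a × w ≡ c)
  removed⇒ {u} {w} eq with ∨-true⁻ {(u == c) ∧ (w == a)} eq
  ... | inj₁ q = inj₁ (==⇒≡ (∧-trueˡ q) , ==⇒≡ (∧-trueʳ {u == c} q))
  ... | inj₂ q = inj₂ (==⇒≡ (∧-trueˡ q) , ==⇒≡ (∧-trueʳ {u == a} q))

  c∉S : S c ≡ false
  c∉S with S c in c∈
  ... | false = refl
  ... | true with reach⇒walk n c∈
  ...   | _ , _ , ω with shortcut ω
  ...     | _ , _ , ω′ , uniq = ⊥-elim (acyclic (vertices ω′)
    (((All.tabulate (λ _ → refl) , Linked.map ∧-trueˡ (proj₂ (vertices-isWalk ω′))) , uniq) ,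
     3≤length ω′ , a , c , vertices-head ω′ , vertices-last ω′ , ca))
    where
      a≢c : a ≢ c
      a≢c refl = true≢false (trans (sym ca) (Graph.irrefl T a))
      3≤length : ∀ {k} (ω : Walk allV cut a c k) → 3 ≤ length (vertices ω)
      3≤length (nil _) = contradiction refl a≢c
      3≤length (cons _ e (nil _)) rewrite ==-refl a | ==-refl c | Bool.∨-zeroʳ ((a == c) ∧ (c == a)) =
        contradiction (trans (sym e) (Bool.∧-zeroʳ (adj T a c))) true≢false
      3≤length (cons _ _ (cons _ _ ω)) = s≤s (s≤s (subst (1 ≤_) (sym (vertices-length ω)) (s≤s z≤n)))

  edge-out : ∀ {s z} → S s ≡ true → S z ≡ false → adj T s z ≡ true → s ≡ a × z ≡ c
  edge-out {s} {z} s∈ z∉ e with cut s z in kept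
  ... | true with reach⇒walk n s∈
  ...   | _ , _ , ω = contradiction (trans (sym (walk⇒S (snocʷ ω kept refl))) z∉) true≢false
  edge-out {s} {z} s∈ z∉ e | false
    with removed⇒ {s} {z} (not-false (trans (cong (λ t → t ∧ not (removed s z)) (sym e)) kept))
  ...   | inj₁ (refl , _) = contradiction (trans (sym s∈) c∉S) true≢false
  ...   | inj₂ eqs = eqs

  hangs : HangsAt (adj T) S c
  hangs = record { anchor∉ = c∉S ; exit = λ s∈ z∉ e → proj₂ (edge-out s∈ z∉ e) }

  attached-at-a : ∀ {s} → S s ≡ true → adj T s c ≡ true → s ≡ a
  attached-at-a s∈ e = proj₁ (edge-out s∈ c∉S e)

  crossing-in : ∀ {x xs y} → Linked (λ s t → adj T s t ≡ true) (x ∷ xs) → S x ≡ false → S y ≡ true →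
    y ∈ x ∷ xs → ∃[ pre ] ∃[ post ] x ∷ xs ≡ pre ++ c ∷ a ∷ post
  crossing-in linked x∉ y∈S y∈
    with first-crossing (λ z → S z Bool.≟ false) x∉ (λ y∉ → true≢false (trans (sym y∈S) y∉)) y∈
  ... | pre , s , z , post , eq , s∉ , z∈
    with edge-out (Bool.¬-not z∈) s∉ (trans (Graph.sym T _ s) (Linked-middle pre (subst (Linked _) eq linked)))
  ...   | refl , refl = pre , post , eq

  crossing-out : ∀ {x xs y} → Linked (λ s t → adj T s t ≡ true) (x ∷ xs) → S x ≡ true → S y ≡ false →
    y ∈ x ∷ xs → ∃[ pre ] ∃[ post ] x ∷ xs ≡ pre ++ a ∷ c ∷ post
  crossing-out linked x∈ y∉ y∈
    with first-crossing (λ z → S z Bool.≟ true) x∈ (λ y∈S → true≢false (trans (sym y∈S) y∉)) y∈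
  ... | pre , s , z , post , eq , s∈ , z∉
    with edge-out s∈ (Bool.¬-not z∉) (Linked-middle pre (subst (Linked _) eq linked))
  ...   | refl , refl = pre , post , eq

index-in : ∀ {A : Set} (q : List A) pre x post → q ≡ pre ++ x ∷ post →
  ∃ λ (i : Fin (length q)) → toℕ i ≡ length pre × lookup q i ≡ x
index-in _ [] x post refl = zero , refl , refl
index-in _ (y ∷ pre) x post refl with index-in _ pre x post refl
... | i , toℕi , lookup≡ = suc i , cong suc toℕi , lookup≡

module RootedPaths {n} (G T : Graph n) (r : Fin n) (root : IsRoot G T r) where

  root-path-nonadjacent : ∀ {q} → IsPath allV (adj T) q → head q ≡ just r →
    ∀ pre {x y mid z post} → q ≡ pre ++ x ∷ y ∷ mid ++ z ∷ post → adj G x z ≡ false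
  root-path-nonadjacent {q} path head≡ pre {x} {y} {mid} {z} {post} eq
    with index-in q pre x _ eq
       | index-in q (pre ++ x ∷ y ∷ mid) z post (trans eq (sym (++-assoc pre (x ∷ y ∷ mid) (z ∷ post))))
  ... | i , toℕi , qi≡x | j , toℕj , qj≡z =
    subst₂ (λ s t → adj G s t ≡ false) qi≡x qj≡z (root q path head≡ i j i+1<j)
    where
      i+1<j : suc (toℕ i) < toℕ j
      i+1<j rewrite toℕi | toℕj | length-++ pre {x ∷ y ∷ mid} =
        subst (_≤ length pre + suc (suc (length mid))) (+-comm (length pre) 2)
              (+-monoʳ-≤ (length pre) (s≤s (s≤s z≤n)))

module-adj : ∀ {n k} (G : Graph n) (part : Fin n → Fin k) → IsModularPartition G part →
  ∀ {x y v} → part x ≡ part y → part v ≢ part x → adj G v x ≡ adj G v y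
module-adj G part (_ , _ , modular) {x} {y} {v} same other = modular (part x) x y v refl (sym same) other

module PolyStarMAD {n k} (G : Graph n) (part : Fin n → Fin k) (T : Graph n) (r : Fin n) (d : Fin k → Fin n)
  (modular : IsModularPartition G part) (mad : IsMAD G T) (poly-star : IsPolyStar part T)
  (root : IsRoot G T r) (d-part : ∀ j → part (d j) ≡ j) (d-root : d (part r) ≡ r)
  (d-max : ∀ j → j ≢ part r → ∀ v → part v ≡ j → deg T v ≤ deg T (d j)) where

  open RootedPaths G T r root public

  i : Fin k
  i = part r

  T⊆G : ∀ {u v} → adj T u v ≡ true → adj G u v ≡ true
  T⊆G = proj₁ (proj₁ mad) _ _

  T-connected : Connected allV (adj T)
  T-connected = proj₁ (proj₂ (proj₁ mad))

  T-acyclic : Acyclic allV (adj T)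
  T-acyclic = proj₂ (proj₂ (proj₁ mad))

  T-walk : ∀ u v → ∃[ k ] Walk allV (adj T) u v k
  T-walk u v = Connected⇒walk T-connected refl refl

  open Metric (adj T) (Graph.sym T) T-walk public

  δ-via-anchor : ∀ {S h} → HangsAt (adj T) S h →
    ∀ {s w} → S s ≡ true → S w ≡ false → δ s w ≡ δ s h + δ h w
  δ-via-anchor hangs = Hanging.Distances.δ-via-anchor hangs (Graph.sym T) T-walk

  T-sym : ∀ {u v} → adj T u v ≡ true → adj T v u ≡ true
  T-sym {u} {v} e = trans (Graph.sym T v u) e

  T-irrefl : ∀ {u v} → adj T u v ≡ true → u ≢ v
  T-irrefl {u} e refl = true≢false (trans (sym e) (Graph.irrefl T u))

  G-sym : ∀ {u v} → adj G u v ≡ true → adj G v u ≡ true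
  G-sym {u} {v} e = trans (Graph.sym G v u) e

  another-module : ∃[ j ] j ≢ i
  another-module = pick (proj₁ modular) i
    where
      pick : ∀ {k} → 2 ≤ k → (i : Fin k) → ∃[ j ] j ≢ i
      pick (s≤s (s≤s _)) zero = suc zero , λ ()
      pick (s≤s (s≤s _)) (suc _) = zero , λ ()

  -- A vertex outside Mᵢ with a neighbour in Mᵢ is G-adjacent to r, as Mᵢ is a module; on an induced
  -- path from r it therefore sits right next to r.
  far-from-root-module : ∀ {q} → IsPath allV (adj T) q → head q ≡ just r →
    ∀ pre {w post} → q ≡ pre ++ w ∷ post → 2 ≤ length pre →
    part w ≢ i → ∀ {m} → adj T w m ≡ true → part m ≢ i
  far-from-root-module path head≡ (x ∷ y ∷ mid) {w} refl _ w∉ {m} wm m∈ with head≡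
  ... | refl = true≢false (trans (sym G-wr) (trans (Graph.sym G w r) (root-path-nonadjacent path refl [] refl)))
    where
      G-wr : adj G w r ≡ true
      G-wr = trans (sym (module-adj G part modular m∈ λ w≡m → w∉ (trans w≡m m∈))) (T⊆G wm)
  far-from-root-module _ _ (_ ∷ []) _ (s≤s ())

  -- The tree on D

  D : VSet n
  D = Dset d

  D⇒d : ∀ {v} → D v ≡ true → v ≡ d (part v)
  D⇒d {v} v∈D with any-allFin⁻ (λ j → d j == v) v∈D
  ... | j , dj==v with ==⇒≡ {u = d j} dj==v
  ...   | refl = cong d (sym (d-part j))

  d∈D : ∀ j → D (d j) ≡ true
  d∈D j = any-allFin⁺ (λ j′ → d j′ == d j) j (==-refl (d j))

  d⇒D : ∀ {v} → v ≡ d (part v) → D v ≡ true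
  d⇒D eq = subst (λ z → D z ≡ true) (sym eq) (d∈D _)

  r∈D : D r ≡ true
  r∈D = d⇒D (sym d-root)

  D∩Mᵢ⇒r : ∀ {v} → D v ≡ true → part v ≡ i → v ≡ r
  D∩Mᵢ⇒r v∈D v∈Mᵢ = trans (D⇒d v∈D) (trans (cong d v∈Mᵢ) d-root)

  branching⇒d : ∀ {v} → part v ≢ i → 2 ≤ deg T v → v ≡ d (part v)
  branching⇒d {v} v∉Mᵢ 2≤deg =
    sym (poly-star (d (part v)) v (d-part (part v)) (≤-trans 2≤deg (d-max (part v) v∉Mᵢ v refl)) 2≤deg)

  outside-after-root : ∀ {q} → IsPath allV (adj T) q → head q ≡ just r → ∀ {u} → last q ≡ just u →
    part u ≢ i → ∀ pre {a y post} → q ≡ pre ++ a ∷ y ∷ post → part y ≢ i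
  outside-after-root {q} path head≡ last≡ u∉ pre {a} {y} {post} eq y∈
    with first-crossing (λ z → part z ≟ i) y∈ u∉
           (last-∈ (y ∷ post) (trans (sym (last-++-∷ pre a (y ∷ post))) (trans (cong last (sym eq)) last≡)))
  ... | mid , z , w , post′ , eq′ , z∈ , w∉ =
    far-from-root-module path head≡ (pre ++ a ∷ (mid ∷ʳ z)) reassociated (2≤length pre) w∉ (T-sym zw) z∈
    where
      reassociated : q ≡ (pre ++ a ∷ (mid ∷ʳ z)) ++ w ∷ post′
      reassociated = begin
        q                                         ≡⟨ eq ⟩
        pre ++ a ∷ y ∷ post                       ≡⟨ cong (λ t → pre ++ a ∷ t) eq′ ⟩
        pre ++ a ∷ (mid ++ z ∷ w ∷ post′)         ≡⟨ cong (λ t → pre ++ a ∷ t) (sym (∷ʳ-++ mid z (w ∷ post′))) ⟩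
        pre ++ a ∷ (mid ∷ʳ z) ++ w ∷ post′        ≡⟨ sym (++-assoc pre (a ∷ (mid ∷ʳ z)) (w ∷ post′)) ⟩
        (pre ++ a ∷ (mid ∷ʳ z)) ++ w ∷ post′      ∎
        where open ≡-Reasoning
      2≤length : ∀ pre → 2 ≤ length (pre ++ a ∷ (mid ∷ʳ z))
      2≤length [] = s≤s (subst (1 ≤_) (sym (length-++ mid)) (m≤n+m 1 (length mid)))
      2≤length (_ ∷ pre) = m≤n⇒m≤1+n (2≤length pre)
      zw : adj T z w ≡ true
      zw = Linked-middle mid
        (subst (Linked _) eq′ (Linked.tail (Linked-++⁻ʳ pre (subst (Linked _) eq (proj₂ (proj₁ path))))))

  root-path-in-D : ∀ {u} → D u ≡ true → ∃[ q ] IsPath allV (adj T) q × Ends q r u × All (λ z → D z ≡ true) q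
  root-path-in-D {u} u∈D with u ≟ r
  ... | yes refl = u ∷ [] , ((refl ∷ [] , [-]) , [] ∷ []) , (refl , refl) , u∈D ∷ []
  ... | no u≢r with T-connected r u refl refl
  ...   | q , path , head≡ , last≡ = q , path , (head≡ , last≡) , All.tabulate in-D
    where
      in-D : ∀ {y} → y ∈ q → D y ≡ true
      in-D {y} y∈ with position q y∈
      ... | inj₁ head≡y with trans (sym head≡) head≡y
      ...   | refl = r∈D
      in-D {y} y∈ | inj₂ (inj₁ last≡y) with trans (sym last≡) last≡y
      ...   | refl = u∈D
      in-D {y} y∈ | inj₂ (inj₂ (pre , a , b , post , eq)) =
        d⇒D (branching⇒d (outside-after-root path head≡ last≡ (u≢r ∘ D∩Mᵢ⇒r u∈D) pre eq)
                         (interior⇒2≤deg T path pre eq))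

  D-tree : IsTree D (adj T)
  D-tree = connected , acyclic
    where
      from-root : ∀ {u} → D u ≡ true → ∃[ k ] Walk D (adj T) r u k
      from-root u∈D with root-path-in-D u∈D
      ... | q , ((_ , linked) , _) , ends , in-D = _ , toWalk q (in-D , linked) ends
      connected : Connected D (adj T)
      connected u v u∈D v∈D =
        walk⇒path (reverseʷ (Graph.sym T) (proj₂ (from-root u∈D)) ++ʷ proj₂ (from-root v∈D))
      acyclic : Acyclic D (adj T)
      acyclic p (path , rest) = T-acyclic p (IsPath⇒allV path , rest)

  -- Leaves of the other modules

  -- If the leaf v hangs at x, re-attaching v at c and re-attaching the branch behind d j at x give
  -- opposite inequalities between the distance sums of x and c, which force δ x c = 0.
  module LeafHost (j : Fin k) (j≢i : j ≢ i) (pre : List (Fin n)) (c : Fin n)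
    (p-path : IsPath D (adj T) (pre ++ c ∷ d j ∷ [])) (p-head : head (pre ++ c ∷ d j ∷ []) ≡ just r)
    {v x : Fin n} (v∈Mⱼ : part v ≡ j) (v≢dⱼ : v ≢ d j) (v-leaf : deg T v ≡ 1)
    (vx : adj T v x ≡ true) (sole : ∀ {w} → adj T v w ≡ true → w ≡ x) where

    p : List (Fin n)
    p = pre ++ c ∷ d j ∷ []

    path : IsPath allV (adj T) p
    path = IsPath⇒allV p-path

    linked : Linked (λ s t → adj T s t ≡ true) p
    linked = proj₂ (proj₁ path)

    c-dⱼ : adj T c (d j) ≡ true
    c-dⱼ = Linked-middle pre linked

    c∉Mⱼ : part c ≢ j
    c∉Mⱼ c∈Mⱼ =
      T-irrefl c-dⱼ (trans (D⇒d (All.lookup (proj₁ (proj₁ p-path)) (∈-++⁺ʳ pre (here refl)))) (cong d c∈Mⱼ))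

    G-cv : adj G c v ≡ true
    G-cv = trans
      (sym (module-adj G part modular (trans (d-part j) (sym v∈Mⱼ)) λ c∈ → c∉Mⱼ (trans c∈ (d-part j))))
                 (T⊆G c-dⱼ)

    v≢r : v ≢ r
    v≢r refl = j≢i (sym v∈Mⱼ)

    extension-nonadjacent : adj T (d j) v ≡ true → adj G c v ≡ false
    extension-nonadjacent dⱼv =
      root-path-nonadjacent extended (trans (head-++-∷ pre) p-head) pre {mid = []} {post = []} refl
      where
        v∉p : v ∉ p
        v∉p v∈p = v≢dⱼ (trans (D⇒d (All.lookup (proj₁ (proj₁ p-path)) v∈p)) (cong d v∈Mⱼ))
        extended : IsPath allV (adj T) (pre ++ c ∷ d j ∷ v ∷ [])
        extended = subst (IsPath allV (adj T)) (++-assoc pre (c ∷ d j ∷ []) (v ∷ []))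
          ((All.tabulate (λ _ → refl) , Linked-∷ʳ p linked (last-++-∷ pre c (d j ∷ [])) dⱼv) ,
           Unique-∷ʳ p (proj₂ path) v∉p)

    host-in-Mⱼ⇒dⱼ : part x ≡ j → x ≡ d j
    host-in-Mⱼ⇒dⱼ x∈Mⱼ with T-connected r x refl refl
    ... | q , q-path , q-head , q-last
      with split-last-two q q-head q-last (λ r≡x → j≢i (trans (sym x∈Mⱼ) (cong part (sym r≡x))))
    ...   | pre′ , y , refl =
      trans (branching⇒d (λ x∈Mᵢ → j≢i (trans (sym x∈Mⱼ) x∈Mᵢ)) (2≤deg T xy (T-sym vx) y≢v))
                                    (cong d x∈Mⱼ)
      where
        xy : adj T x y ≡ true
        xy = T-sym (Linked-middle pre′ (proj₂ (proj₁ q-path)))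
        y≢v : y ≢ v
        y≢v refl = contradiction
          (subst (2 ≤_) v-leaf (inner⇒2≤deg T q-path (∈-++⁺ʳ pre′ (here refl))
            (λ head≡ → v≢r (sym (Maybe.just-injective (trans (sym q-head) head≡))))
            (λ last≡ → T-irrefl vx (sym (Maybe.just-injective (trans (sym q-last) last≡))))))
          (λ { (s≤s ()) })

    x∉Mⱼ : part x ≢ j
    x∉Mⱼ x∈Mⱼ = true≢false (trans (sym G-cv)
      (extension-nonadjacent (subst (λ t → adj T t v ≡ true) (host-in-Mⱼ⇒dⱼ x∈Mⱼ) (T-sym vx))))

    G-xdⱼ : adj G x (d j) ≡ true
    G-xdⱼ = trans
      (sym (module-adj G part modular (trans v∈Mⱼ (sym (d-part j))) λ x∈ → x∉Mⱼ (trans x∈ v∈Mⱼ)))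
                  (T⊆G (T-sym vx))

    open Branch T T-acyclic c-dⱼ

    r∉S : S r ≡ false
    r∉S with S r in r∈S | head-just p p-head
    ... | false | _ = refl
    ... | true | rest , p≡
      with crossing-out (subst (Linked _) p≡ linked) r∈S c∉S (subst (c ∈_) p≡ (∈-++⁺ʳ pre (here refl)))
    ...   | A , B , eq with ∈-∃++ (last-∈ (c ∷ B) (trans (sym (last-++-∷ A (d j) (c ∷ B)))
                                 (trans (cong last (sym (trans p≡ eq))) (last-++-∷ pre c (d j ∷ [])))))
    ...     | X , Y , c∷B≡ =
      ⊥-elim (¬Unique-twice A (subst Unique (trans (trans p≡ eq) (cong (λ t → A ++ d j ∷ t) c∷B≡)) (proj₂ path)))

    v∉S : S v ≡ false
    v∉S with S v in v∈S
    ... | false = refl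
    ... | true with T-connected r v refl refl
    ...   | q , q-path , q-head , q-last with head-just q q-head
    ...     | rest , refl with crossing-in (proj₂ (proj₁ q-path)) r∉S v∈S (last-∈ _ q-last)
    ...       | A , B , eq
      with last-∈ (d j ∷ B) (trans (sym (last-++-∷ A c (d j ∷ B))) (trans (cong last (sym eq)) q-last))
    ...         | here v≡dⱼ = contradiction v≡dⱼ v≢dⱼ
    ...         | there v∈B with ∈-∃++ v∈B
    ...           | X , Y , refl = contradiction (trans (sym G-cv) (root-path-nonadjacent q-path q-head A eq)) true≢false

    x∉S : S x ≡ false
    x∉S with S x in x∈S
    ... | false = refl
    ... | true = contradiction (trans (cong part (sym (proj₂ (edge-out x∈S v∉S (T-sym vx))))) v∈Mⱼ) c∉Mⱼ

    c≠v : (c == v) ≡ false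
    c≠v = ≢⇒==-false λ c≡v → c∉Mⱼ (trans (cong part c≡v) v∈Mⱼ)

    v-hangs : HangsAt (adj T) (_== v) x
    v-hangs = record
      { anchor∉ = ≢⇒==-false λ x≡v → T-irrefl vx (sym x≡v)
      ; exit = λ {s} s==v _ e → sole (subst (λ t → adj T t _ ≡ true) (==⇒≡ s==v) e) }

    move-leaf : sumOutside (_== v) (δ x) ≤ sumOutside (_== v) (δ c)
    move-leaf = Rehang.sumOutside-anchor≤ G T mad v-hangs c≠v
      (λ s==v _ → subst (λ t → adj G t c ≡ true) (sym (==⇒≡ s==v)) (G-sym G-cv))
      (rehang-leaves-acyclic T T-acyclic (_== v) (HangsAt.anchor∉ v-hangs)
         λ s==v e → sole (subst (λ t → adj T t _ ≡ true) (==⇒≡ s==v) e))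
      {v} (==-refl v)

    move-branch : sumOutside S (δ c) ≤ sumOutside S (δ x)
    move-branch = Rehang.sumOutside-anchor≤ G T mad hangs x∉S
      (λ s∈ sc → subst (λ t → adj G t x ≡ true) (sym (attached-at-a s∈ sc)) (G-sym G-xdⱼ))
      (rehang-branch-acyclic T T-acyclic S c∉S attached-at-a)
      a∈S

    L : ℕ
    L = δ x c

    remaining : (Fin n → ℕ) → ℕ
    remaining f = sumOutside (λ w → S w ∨ (w == v)) f

    v-only : ∀ {w} → (w == v) ≡ true → S w ≡ false
    v-only {w} w==v = subst (λ t → S t ≡ false) (sym (==⇒≡ {u = w} w==v)) v∉S

    leaf-split : ∀ f → sumOutside (_== v) f ≡ remaining f + sumInside S f
    leaf-split f =
      trans (sumOutside-split (_== v) S f λ w∈S → Bool.¬-not λ w==v → true≢false (trans (sym w∈S) (v-only w==v)))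
      (cong (_+ sumInside S f) (sumOutside-∨-comm (_== v) S f))

    branch-split : ∀ f → sumOutside S f ≡ remaining f + f v
    branch-split f = trans (sumOutside-split S (_== v) f v-only) (cong (remaining f +_) (sum-at v f))

    δ-xw : ∀ {w} → S w ≡ true → δ x w ≡ L + δ c w
    δ-xw {w} w∈S = begin
      δ x w          ≡⟨ δ-sym x w ⟩
      δ w x          ≡⟨ δ-via-anchor hangs w∈S x∉S ⟩
      δ w c + δ c x  ≡⟨ cong₂ _+_ (δ-sym w c) (δ-sym c x) ⟩
      δ c w + L      ≡⟨ +-comm (δ c w) L ⟩
      L + δ c w      ∎
      where open ≡-Reasoning

    δ-xv : δ x v ≡ 1
    δ-xv = δ-adjacent (T-sym vx) λ x≡v → T-irrefl vx (sym x≡v)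

    δ-cv : δ c v ≡ suc L
    δ-cv = begin
      δ c v          ≡⟨ δ-sym c v ⟩
      δ v c          ≡⟨ δ-via-anchor v-hangs (==-refl v) c≠v ⟩
      δ v x + δ x c  ≡⟨ cong (_+ L) (trans (δ-sym v x) δ-xv) ⟩
      suc L          ∎
      where open ≡-Reasoning

    remaining-x≤c : remaining (δ x) ≤ remaining (δ c)
    remaining-x≤c = +-cancelʳ-≤ (sumInside S (δ x)) _ _ (begin
      remaining (δ x) + sumInside S (δ x)  ≡⟨ sym (leaf-split (δ x)) ⟩
      sumOutside (_== v) (δ x)             ≤⟨ move-leaf ⟩
      sumOutside (_== v) (δ c)             ≡⟨ leaf-split (δ c) ⟩
      remaining (δ c) + sumInside S (δ c)  ≤⟨ +-monoʳ-≤ (remaining (δ c))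
                                                (sumInside-mono-≤ S λ w∈S → subst (_ ≤_) (sym (δ-xw w∈S)) (m≤n+m _ L)) ⟩
      remaining (δ c) + sumInside S (δ x)  ∎)
      where open ≤-Reasoning

    remaining-c+L≤x : remaining (δ c) + L ≤ remaining (δ x)
    remaining-c+L≤x = ≤-pred (begin
      suc (remaining (δ c) + L)    ≡⟨ sym (+-suc _ L) ⟩
      remaining (δ c) + suc L      ≡⟨ cong (remaining (δ c) +_) (sym δ-cv) ⟩
      remaining (δ c) + δ c v      ≡⟨ sym (branch-split (δ c)) ⟩
      sumOutside S (δ c)           ≤⟨ move-branch ⟩
      sumOutside S (δ x)           ≡⟨ branch-split (δ x) ⟩
      remaining (δ x) + δ x v      ≡⟨ cong (remaining (δ x) +_) δ-xv ⟩
      remaining (δ x) + 1          ≡⟨ +-comm _ 1 ⟩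
      suc (remaining (δ x))        ∎)
      where open ≤-Reasoning

    x≡c : x ≡ c
    x≡c = δ≡0⇒≡ (n≤0⇒n≡0 (+-cancelˡ-≤ (remaining (δ c)) L 0
      (≤-trans remaining-c+L≤x (≤-trans remaining-x≤c (≤-reflexive (sym (+-identityʳ _)))))))

  non-root-module-leaves : ∀ j → j ≢ i → ∀ p → IsPath D (adj T) p → Ends p r (d j) →
    Σ (Fin n) (λ c → (c ∈ p) × (adj T c (d j) ≡ true) ×
      (∀ c′ → c′ ∈ p → adj T c′ (d j) ≡ true → c′ ≡ c) ×
      (∀ v → part v ≡ j → v ≢ d j → deg T v ≡ 1 → NbhdIsSingleton T v c))
  non-root-module-leaves j j≢i p p-path (p-head , p-last)
    with split-last-two p p-head p-last (λ r≡dⱼ → j≢i (trans (sym (d-part j)) (cong part (sym r≡dⱼ))))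
  ... | pre , c , refl = c , ∈-++⁺ʳ pre (here refl) , c-dⱼ , only-c , leaves
    where
      path : IsPath allV (adj T) p
      path = IsPath⇒allV p-path
      c-dⱼ : adj T c (d j) ≡ true
      c-dⱼ = Linked-middle pre (proj₂ (proj₁ path))
      earlier-nonadjacent : ∀ A B {c′} → pre ≡ A ++ c′ ∷ B → adj G c′ (d j) ≡ false
      earlier-nonadjacent A [] {c′} refl =
        root-path-nonadjacent path p-head A {mid = []} (++-assoc A (c′ ∷ []) (c ∷ d j ∷ []))
      earlier-nonadjacent A (b ∷ B) {c′} refl =
        root-path-nonadjacent path p-head A {mid = B ∷ʳ c}
          (trans (++-assoc A (c′ ∷ b ∷ B) (c ∷ d j ∷ [])) (cong (λ t → A ++ c′ ∷ b ∷ t) (sym (∷ʳ-++ B c (d j ∷ [])))))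
      only-c : ∀ c′ → c′ ∈ p → adj T c′ (d j) ≡ true → c′ ≡ c
      only-c c′ c′∈ c′dⱼ with ∈-++⁻ pre c′∈
      ... | inj₂ (here refl) = refl
      ... | inj₂ (there (here refl)) = contradiction refl (T-irrefl c′dⱼ)
      ... | inj₁ c′∈pre with ∈-∃++ c′∈pre
      ...   | A , B , pre≡ = contradiction (trans (sym (T⊆G c′dⱼ)) (earlier-nonadjacent A B pre≡)) true≢false
      leaves : ∀ v → part v ≡ j → v ≢ d j → deg T v ≡ 1 → NbhdIsSingleton T v c
      leaves v v∈Mⱼ v≢dⱼ v-leaf w with deg≡1⇒sole-neighbour T v-leaf
      ... | x , vx , sole = (λ vw → trans (sole vw) x≡c) , λ { refl → subst (λ t → adj T v t ≡ true) x≡c vx }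
        where open LeafHost j j≢i pre c p-path p-head v∈Mⱼ v≢dⱼ v-leaf vx sole using (x≡c)

  -- Leaves of the root module

  path₃ : ∀ {y x} → adj T r y ≡ true → adj T y x ≡ true → r ≢ x →
    IsPath allV (adj T) (r ∷ y ∷ x ∷ [])
  path₃ ry yx r≢x = ((refl ∷ refl ∷ refl ∷ []) , (ry ∷ yx ∷ [-])) ,
    ((T-irrefl ry ∷ r≢x ∷ []) ∷ (T-irrefl yx ∷ []) ∷ [] ∷ [])

  path₄ : ∀ {y x z} → adj T r y ≡ true → adj T y x ≡ true → adj T x z ≡ true →
    r ≢ x → r ≢ z → y ≢ z → IsPath allV (adj T) (r ∷ y ∷ x ∷ z ∷ [])
  path₄ ry yx xz r≢x r≢z y≢z = ((refl ∷ refl ∷ refl ∷ refl ∷ []) , (ry ∷ yx ∷ xz ∷ [-])) ,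
    ((T-irrefl ry ∷ r≢x ∷ r≢z ∷ []) ∷ (T-irrefl yx ∷ y≢z ∷ []) ∷ (T-irrefl xz ∷ []) ∷ [] ∷ [])

  -- Otherwise y branches, so all its neighbours lie in Mᵢ and are leaves, and the component of y
  -- would not leave Mᵢ.
  root-module-neighbour-leaf : ∀ {y z} → adj T r y ≡ true → part y ≡ i → adj T y z ≡ true → z ≡ r
  root-module-neighbour-leaf {y} {z} ry y∈Mᵢ yz with z ≟ r
  ... | yes z≡r = z≡r
  ... | no z≢r = ⊥-elim (proj₂ another-module
          (trans (sym (d-part (proj₁ another-module))) (stays-in-Mᵢ (proj₂ (T-walk y (d (proj₁ another-module)))))))
    where
      2≤deg-y : 2 ≤ deg T y
      2≤deg-y = 2≤deg T (T-sym ry) yz λ r≡z → z≢r (sym r≡z)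
      neighbour∈Mᵢ : ∀ {t} → adj T y t ≡ true → part t ≡ i
      neighbour∈Mᵢ {t} yt with t ≟ r | part t ≟ i
      ... | yes refl | _ = refl
      ... | no _ | yes t∈Mᵢ = t∈Mᵢ
      ... | no t≢r | no t∉Mᵢ = ⊥-elim
        (far-from-root-module (path₃ ry yt λ r≡t → t≢r (sym r≡t)) refl (r ∷ y ∷ []) refl (s≤s (s≤s z≤n))
          t∉Mᵢ (T-sym yt) y∈Mᵢ)
      neighbour-leaf : ∀ {t t′} → adj T y t ≡ true → adj T t t′ ≡ true → t′ ≡ y
      neighbour-leaf yt tt′ = deg<2⇒same-neighbour T
        (λ 2≤ → T-irrefl yt (sym (poly-star _ _ (trans (neighbour∈Mᵢ yt) (sym y∈Mᵢ)) 2≤ 2≤deg-y))) tt′ (T-sym yt)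
      Near : Fin n → Set
      Near t = t ≡ y ⊎ adj T y t ≡ true
      stays-in-Mᵢ : ∀ {w k} → Walk allV (adj T) y w k → part w ≡ i
      stays-in-Mᵢ ω
        with walk-closed Near (λ { (inj₁ refl) e → inj₂ e ; (inj₂ yt) e → inj₁ (neighbour-leaf yt e) }) ω (inj₁ refl)
      ... | inj₁ refl = y∈Mᵢ
      ... | inj₂ yw = neighbour∈Mᵢ yw

  -- If x had a neighbour besides y, it would be the branching vertex of Mᵢ and its other neighbours
  -- would be leaves in Mᵢ. Re-attaching them at y brings them closer to everything outside them
  -- and x, in particular to r and y, and further only from x.
  module GrandchildBranching {y x z} (ry : adj T r y ≡ true) (yx : adj T y x ≡ true) (x≢r : x ≢ r)
    (y∉Mᵢ : part y ≢ i) (x∈Mᵢ : part x ≡ i) (xz : adj T x z ≡ true) (z≢y : z ≢ y) where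

    2≤deg-x : 2 ≤ deg T x
    2≤deg-x = 2≤deg T (T-sym yx) xz λ y≡z → z≢y (sym y≡z)

    x≁r : adj T x r ≡ false
    x≁r with adj T x r in xr
    ... | false = refl
    ... | true =
      contradiction (deg<2⇒same-neighbour T (λ 2≤ → x≢r (poly-star x r x∈Mᵢ 2≤deg-x 2≤)) (T-sym xr) ry)
                               (T-irrefl yx ∘ sym)

    Children : VSet n
    Children w = adj T x w ∧ not (w == y)

    child-x : ∀ {w} → Children w ≡ true → adj T x w ≡ true
    child-x = ∧-trueˡ

    child≢y : ∀ {w} → Children w ≡ true → w ≢ y
    child≢y {w} w∈ refl = true≢false (trans (sym (∧-trueʳ {adj T x w} w∈)) (cong not (==-refl w)))

    child≢r : ∀ {w} → Children w ≡ true → w ≢ r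
    child≢r w∈ refl = true≢false (trans (sym (child-x w∈)) x≁r)

    child∈Mᵢ : ∀ {w} → Children w ≡ true → part w ≡ i
    child∈Mᵢ {w} w∈ with part w ≟ i
    ... | yes w∈Mᵢ = w∈Mᵢ
    ... | no w∉Mᵢ = ⊥-elim (far-from-root-module
          (path₄ ry yx (child-x w∈) (x≢r ∘ sym) (child≢r w∈ ∘ sym) (child≢y w∈ ∘ sym))
          refl (r ∷ y ∷ x ∷ []) refl (s≤s (s≤s z≤n)) w∉Mᵢ (T-sym (child-x w∈)) x∈Mᵢ)

    child-leaf : ∀ {s t} → Children s ≡ true → adj T s t ≡ true → t ≡ x
    child-leaf s∈ st = deg<2⇒same-neighbour T
      (λ 2≤ → T-irrefl (child-x s∈) (sym (poly-star _ _ (trans (child∈Mᵢ s∈) (sym x∈Mᵢ)) 2≤ 2≤deg-x)))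
      st (T-sym (child-x s∈))

    x∉Children : Children x ≡ false
    x∉Children rewrite Graph.irrefl T x = refl

    y∉Children : Children y ≡ false
    y∉Children rewrite ==-refl y = Bool.∧-zeroʳ (adj T x y)

    children-hang : HangsAt (adj T) Children x
    children-hang = record { anchor∉ = x∉Children ; exit = λ s∈ _ st → child-leaf s∈ st }

    move-children : sumOutside Children (δ x) ≤ sumOutside Children (δ y)
    move-children = Rehang.sumOutside-anchor≤ G T mad children-hang y∉Children
      (λ s∈ _ → G-sym (trans (sym (module-adj G part modular (trans x∈Mᵢ (sym (child∈Mᵢ s∈))) λ y∈ → y∉Mᵢ (trans y∈ x∈Mᵢ)))
                             (T⊆G yx)))
      (rehang-leaves-acyclic T T-acyclic Children x∉Children child-leaf)
      {z} (∧-true xz (cong not (≢⇒==-false z≢y)))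

    Family : VSet n
    Family w = Children w ∨ (w == x)

    family-hangs : HangsAt (adj T) Family y
    family-hangs = record
      { anchor∉ = trans (cong (_∨ (y == x)) y∉Children) (≢⇒==-false (T-irrefl yx)) ; exit = exit }
      where
        exit : ∀ {s t} → Family s ≡ true → Family t ≡ false → adj T s t ≡ true → t ≡ y
        exit {s} {t} s∈ t∉ st with ∨-false⁻ {Children t} t∉ | ∨-true⁻ {Children s} s∈
        ... | _ , t≠x | inj₁ s-child = contradiction (trans (sym (≡⇒== (child-leaf s-child st))) t≠x) true≢false
        ... | t-not-child , _ | inj₂ s==x rewrite ==⇒≡ {u = s} s==x =
          ==⇒≡ (not-false (trans (cong (λ b → b ∧ not (t == y)) (sym st)) t-not-child))

    x∈Family : Family x ≡ true
    x∈Family = trans (cong (Children x ∨_) (==-refl x)) (Bool.∨-zeroʳ _)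

    δ-from-x : ∀ {w} → Family w ≡ false → δ x w ≡ 1 + δ y w
    δ-from-x w∉ = trans (δ-via-anchor family-hangs x∈Family w∉)
                        (cong (_+ δ y _) (trans (δ-sym x y) (δ-adjacent yx (T-irrefl yx))))

    split : ∀ f → sumOutside Children f ≡ sumOutside Family f + f x
    split f = trans
      (sumOutside-split Children (_== x) f λ {w} w==x → subst (λ t → Children t ≡ false) (sym (==⇒≡ {u = w} w==x)) x∉Children)
                    (cong (sumOutside Family f +_) (sum-at x f))

    outside-count : ℕ
    outside-count = sumOutside Family (λ _ → 1)

    2≤outside-count : 2 ≤ outside-count
    2≤outside-count =
      subst (_≤ outside-count) (cong₂ (λ a b → (if a then 0 else 1) + (if b then 0 else 1)) r∉Family (HangsAt.anchor∉ family-hangs))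
      (two-terms≤sum (λ w → if Family w then 0 else 1) (T-irrefl ry))
      where
        r∉Family : Family r ≡ false
        r∉Family rewrite x≁r | ≢⇒==-false (x≢r ∘ sym) = refl

    impossible : ⊥
    impossible = contradiction (+-cancelʳ-≤ Q outside-count 1 (begin
      outside-count + Q                        ≡⟨ sym (sumOutside-+ Family (λ _ → 1) (δ y)) ⟩
      sumOutside Family (λ w → 1 + δ y w)      ≡⟨ sym (sumOutside-cong Family δ-from-x) ⟩
      sumOutside Family (δ x)                  ≡⟨ sym (+-identityʳ _) ⟩
      sumOutside Family (δ x) + 0              ≡⟨ cong (sumOutside Family (δ x) +_) (sym (δ-self x)) ⟩
      sumOutside Family (δ x) + δ x x          ≡⟨ sym (split (δ x)) ⟩
      sumOutside Children (δ x)                ≤⟨ move-children ⟩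
      sumOutside Children (δ y)                ≡⟨ split (δ y) ⟩
      Q + δ y x                                ≡⟨ cong (Q +_) (δ-adjacent yx (T-irrefl yx)) ⟩
      Q + 1                                    ≡⟨ +-comm Q 1 ⟩
      1 + Q                                    ∎)) (<⇒≱ 2≤outside-count)
      where
        open ≤-Reasoning
        Q = sumOutside Family (δ y)

  grandchild-leaf : ∀ {y x} → adj T r y ≡ true → adj T y x ≡ true → x ≢ r → part y ≢ i → part x ≡ i →
    ∀ {z} → adj T x z ≡ true → z ≡ y
  grandchild-leaf ry yx x≢r y∉Mᵢ x∈Mᵢ {z} xz with z ≟ _
  ... | yes z≡y = z≡y
  ... | no z≢y = ⊥-elim (GrandchildBranching.impossible ry yx x≢r y∉Mᵢ x∈Mᵢ xz z≢y)

  -- Mᵢ ∖ N_T[r]; its complement is the vertex set Rset part T r of R.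
  Far : VSet n
  Far u = (part u == i) ∧ not ((u == r) ∨ adj T r u)

  Far-intro : ∀ {v} → part v ≡ i → v ≢ r → adj T r v ≡ false → Far v ≡ true
  Far-intro {v} v∈Mᵢ v≢r rv rewrite v∈Mᵢ | ==-refl i | ≢⇒==-false v≢r | rv = refl

  Far⇒Mᵢ : ∀ {u} → Far u ≡ true → part u ≡ i
  Far⇒Mᵢ u∈ = ==⇒≡ (∧-trueˡ u∈)

  Far⇒≢r : ∀ {u} → Far u ≡ true → u ≢ r
  Far⇒≢r {u} u∈ refl rewrite ==-refl u = true≢false (sym (∧-trueʳ {part u == part u} u∈))

  Far⇒r≁ : ∀ {u} → Far u ≡ true → adj T r u ≡ false
  Far⇒r≁ {u} u∈ with adj T r u in ru
  ... | false = refl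
  ... | true = contradiction (trans (sym (∧-trueʳ {part u == i} u∈)) (cong not (Bool.∨-zeroʳ (u == r)))) true≢false

  ∉Mᵢ⇒∉Far : ∀ {u} → part u ≢ i → Far u ≡ false
  ∉Mᵢ⇒∉Far u∉Mᵢ rewrite ≢⇒==-false u∉Mᵢ = refl

  record FarHost (u : Fin n) : Set where
    field
      host : Fin n
      root-host : adj T r host ≡ true
      host∉Mᵢ : part host ≢ i
      to-host : adj T u host ≡ true
      only-host : ∀ {z} → adj T u z ≡ true → z ≡ host

  far-host : ∀ {u} → Far u ≡ true → FarHost u
  far-host {u} u∈ with T-connected r u refl refl
  ... | q , q-path , q-head , q-last with head-just q q-head
  ...   | [] , refl = contradiction (Maybe.just-injective q-last) (Far⇒≢r u∈ ∘ sym)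
  ...   | y ∷ [] , refl with refl ← q-last =
    contradiction (Linked.head (proj₂ (proj₁ q-path))) (λ ru → true≢false (trans (sym ru) (Far⇒r≁ u∈)))
  ...   | y ∷ x ∷ rest , refl = record
    { host = y ; root-host = ry ; host∉Mᵢ = y∉Mᵢ ; to-host = T-sym (subst (λ t → adj T y t ≡ true) x≡u yx)
    ; only-host = grandchild-leaf ry yx (r≢x ∘ sym) y∉Mᵢ (subst (λ t → part t ≡ i) (sym x≡u) (Far⇒Mᵢ u∈))
                  ∘ subst (λ t → adj T t _ ≡ true) (sym x≡u) }
    where
      linked = proj₂ (proj₁ q-path)
      ry : adj T r y ≡ true
      ry = Linked.head linked
      yx : adj T y x ≡ true
      yx = Linked.head (Linked.tail linked)
      r≢x : r ≢ x
      r≢x = All.lookup (AllPairs.head (proj₂ q-path)) (there (here refl))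
      y∉Mᵢ : part y ≢ i
      y∉Mᵢ y∈Mᵢ = r≢x (sym (root-module-neighbour-leaf ry y∈Mᵢ yx))
      x∈Mᵢ : part x ≡ i
      x∈Mᵢ with part x ≟ i
      ... | yes x∈Mᵢ = x∈Mᵢ
      ... | no x∉Mᵢ
        with first-crossing (λ t → ¬? (part t ≟ i)) x∉Mᵢ (λ u∉Mᵢ → u∉Mᵢ (Far⇒Mᵢ u∈)) (last-∈ (x ∷ rest) q-last)
      ...   | A , a , b , B , eq , a∉Mᵢ , b∈Mᵢ = ⊥-elim (b∈Mᵢ (far-from-root-module q-path refl (r ∷ y ∷ A)
              (cong (λ t → r ∷ y ∷ t) eq) (s≤s (s≤s z≤n)) a∉Mᵢ
              (Linked-middle A (subst (Linked _) eq (Linked.tail (Linked.tail linked))))))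
      x≡u : x ≡ u
      x≡u = end rest q-last (AllPairs.tail (proj₂ q-path)) (Linked.tail linked)
        where
          end : ∀ rest → last (x ∷ rest) ≡ just u → Unique (y ∷ x ∷ rest) →
            Linked (λ s t → adj T s t ≡ true) (y ∷ x ∷ rest) → x ≡ u
          end [] refl _ _ = refl
          end (z ∷ _) _ ((_ ∷ y≢z ∷ _) ∷ _) (_ ∷ xz ∷ _) =
            ⊥-elim (y≢z (sym (grandchild-leaf ry yx (r≢x ∘ sym) y∉Mᵢ x∈Mᵢ xz)))

  host : ∀ {u} → Far u ≡ true → Fin n
  host u∈ = FarHost.host (far-host u∈)

  move-far : ∀ (S : VSet n) {x x′ s₀} →
    (∀ {s} → S s ≡ true → Far s ≡ true) → (∀ {s} → S s ≡ true → adj T s x ≡ true) →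
    S s₀ ≡ true → adj T r x′ ≡ true → part x′ ≢ i → part x ≢ i → sumOutside S (δ x) ≤ sumOutside S (δ x′)
  move-far S {x} {x′} S⊆Far S-x s₀∈ rx′ x′∉Mᵢ x∉Mᵢ =
    Rehang.sumOutside-anchor≤ G T mad hangs (outside x′∉Mᵢ) G-edge
      (rehang-leaves-acyclic T T-acyclic S (outside x∉Mᵢ) leaf) s₀∈
    where
      outside : ∀ {w} → part w ≢ i → S w ≡ false
      outside {w} w∉Mᵢ with S w in w∈
      ... | false = refl
      ... | true = ⊥-elim (w∉Mᵢ (Far⇒Mᵢ (S⊆Far w∈)))
      leaf : ∀ {s t} → S s ≡ true → adj T s t ≡ true → t ≡ x
      leaf s∈ st = trans (FarHost.only-host (far-host (S⊆Far s∈)) st)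
                         (sym (FarHost.only-host (far-host (S⊆Far s∈)) (S-x s∈)))
      hangs : HangsAt (adj T) S x
      hangs = record { anchor∉ = outside x∉Mᵢ ; exit = λ s∈ _ st → leaf s∈ st }
      G-edge : ∀ {s} → S s ≡ true → adj T s x ≡ true → adj G s x′ ≡ true
      G-edge s∈ _ =
        G-sym (trans (sym (module-adj G part modular (sym (Far⇒Mᵢ (S⊆Far s∈))) x′∉Mᵢ)) (T⊆G (T-sym rx′)))

  Hosted : Fin n → VSet n
  Hosted x w = Far w ∧ adj T x w

  module _ {y} (y∉Mᵢ : part y ≢ i) where

    y≢hosted : ∀ {w} → Hosted y w ≡ true → y ≢ w
    y≢hosted w∈ y≡w = y∉Mᵢ (trans (cong part y≡w) (Far⇒Mᵢ (∧-trueˡ w∈)))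

    δ-hosted : ∀ {w} → Hosted y w ≡ true → δ y w ≡ 1
    δ-hosted {w} w∈ = δ-adjacent (∧-trueʳ {Far w} w∈) (y≢hosted w∈)

    hosted-hangs : HangsAt (adj T) (Hosted y) y
    hosted-hangs = record
      { anchor∉ = cong (_∧ adj T y y) (∉Mᵢ⇒∉Far y∉Mᵢ)
      ; exit = λ {s} s∈ _ st → trans (FarHost.only-host (far-host (∧-trueˡ s∈)) st)
                                     (sym (FarHost.only-host (far-host (∧-trueˡ s∈)) (T-sym (∧-trueʳ {Far s} s∈)))) }

    δ-to-hosted : ∀ {z w} → Hosted y w ≡ true → Hosted y z ≡ false → δ z w ≡ δ z y + 1
    δ-to-hosted {z} {w} w∈ z∉ = begin
      δ z w          ≡⟨ δ-sym z w ⟩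
      δ w z          ≡⟨ δ-via-anchor hosted-hangs w∈ z∉ ⟩
      δ w y + δ y z  ≡⟨ cong₂ _+_ (trans (δ-sym w y) (δ-hosted w∈)) (δ-sym y z) ⟩
      1 + δ z y      ≡⟨ +-comm 1 (δ z y) ⟩
      δ z y + 1      ∎
      where open ≡-Reasoning

  -- Moving the far vertices hosted at x over to another host x′ costs δ x x′ for each far vertex
  -- hosted at x′; doing it in both directions shows that two hosts must coincide.
  module HostMove {u u′} (u∈ : Far u ≡ true) (u′∈ : Far u′ ≡ true) (distinct : host u∈ ≢ host u′∈) where

    x x′ : Fin n
    x = host u∈
    x′ = host u′∈

    x∉Mᵢ : part x ≢ i
    x∉Mᵢ = FarHost.host∉Mᵢ (far-host u∈)

    x′∉Mᵢ : part x′ ≢ i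
    x′∉Mᵢ = FarHost.host∉Mᵢ (far-host u′∈)

    L L′ : VSet n
    L = Hosted x
    L′ = Hosted x′

    N′ : ℕ
    N′ = size L′

    remaining : (Fin n → ℕ) → ℕ
    remaining f = sumOutside (λ w → L w ∨ L′ w) f

    disjoint : ∀ {w} → L′ w ≡ true → L w ≡ false
    disjoint {w} w∈L′ with adj T x w in xw
    ... | false = Bool.∧-zeroʳ (Far w)
    ... | true = ⊥-elim (distinct (trans (FarHost.only-host h (T-sym xw))
                                         (sym (FarHost.only-host h (T-sym (∧-trueʳ {Far w} w∈L′))))))
      where h = far-host (∧-trueˡ w∈L′)

    split : ∀ f → sumOutside L f ≡ remaining f + sumInside L′ f
    split f = sumOutside-split L L′ f disjoint

    move : sumOutside L (δ x) ≤ sumOutside L (δ x′)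
    move = move-far L {s₀ = u} ∧-trueˡ (λ {s} s∈ → T-sym (∧-trueʳ {Far s} s∈))
      (∧-true u∈ (T-sym (FarHost.to-host (far-host u∈)))) (FarHost.root-host (far-host u′∈)) x′∉Mᵢ x∉Mᵢ

    pay : remaining (δ x) + δ x x′ * N′ ≤ remaining (δ x′)
    pay = +-cancelʳ-≤ N′ _ _ (begin
      (remaining (δ x) + K * N′) + N′        ≡⟨ +-assoc (remaining (δ x)) (K * N′) N′ ⟩
      remaining (δ x) + (K * N′ + N′)        ≡⟨ cong (remaining (δ x) +_)
                                                  (sym (trans (*-distribʳ-+ N′ K 1) (cong (K * N′ +_) (*-identityˡ N′)))) ⟩
      remaining (δ x) + (K + 1) * N′         ≡⟨ cong (remaining (δ x) +_) (sym inside-from-x) ⟩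
      remaining (δ x) + sumInside L′ (δ x)   ≡⟨ sym (split (δ x)) ⟩
      sumOutside L (δ x)                     ≤⟨ move ⟩
      sumOutside L (δ x′)                    ≡⟨ split (δ x′) ⟩
      remaining (δ x′) + sumInside L′ (δ x′) ≡⟨ cong (remaining (δ x′) +_) inside-from-x′ ⟩
      remaining (δ x′) + N′                  ∎)
      where
        open ≤-Reasoning
        K = δ x x′
        inside-from-x : sumInside L′ (δ x) ≡ (K + 1) * N′
        inside-from-x = trans (sumInside-cong L′ λ w∈ → δ-to-hosted x′∉Mᵢ w∈ (cong (_∧ adj T x′ x) (∉Mᵢ⇒∉Far x∉Mᵢ)))
                              (sumInside-const L′ (K + 1))
        inside-from-x′ : sumInside L′ (δ x′) ≡ N′
        inside-from-x′ = trans (sumInside-cong L′ (δ-hosted x′∉Mᵢ)) (trans (sumInside-const L′ 1) (*-identityˡ N′))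

  module HostSwap {u₁ u₂} (u₁∈ : Far u₁ ≡ true) (u₂∈ : Far u₂ ≡ true) (distinct : host u₁∈ ≢ host u₂∈) where

    module One = HostMove u₁∈ u₂∈ distinct
    module Two = HostMove u₂∈ u₁∈ (distinct ∘ sym)

    K N₁ N₂ : ℕ
    K = δ One.x One.x′
    N₁ = size (Hosted One.x)
    N₂ = size (Hosted One.x′)

    R : (Fin n → ℕ) → ℕ
    R = One.remaining

    pay-both-ways : R (δ One.x) + (K * N₂ + K * N₁) ≤ R (δ One.x) + 0
    pay-both-ways = begin
      R (δ One.x) + (K * N₂ + K * N₁)                 ≡⟨ sym (+-assoc (R (δ One.x)) (K * N₂) (K * N₁)) ⟩
      R (δ One.x) + K * N₂ + K * N₁                   ≤⟨ +-monoˡ-≤ (K * N₁) One.pay ⟩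
      R (δ One.x′) + K * N₁                           ≡⟨ cong₂ _+_ (sumOutside-∨-comm (Hosted One.x) (Hosted One.x′) (δ One.x′))
                                                                 (cong (_* N₁) (δ-sym One.x One.x′)) ⟩
      Two.remaining (δ Two.x) + δ Two.x Two.x′ * N₁   ≤⟨ Two.pay ⟩
      Two.remaining (δ Two.x′)                        ≡⟨ sumOutside-∨-comm (Hosted One.x′) (Hosted One.x) (δ One.x) ⟩
      R (δ One.x)                                     ≡⟨ sym (+-identityʳ _) ⟩
      R (δ One.x) + 0                                 ∎
      where open ≤-Reasoning

    K*N₁≡0 : K * N₁ ≡ 0
    K*N₁≡0 = n≤0⇒n≡0 (m+n≤o⇒n≤o (K * N₂) (+-cancelˡ-≤ (R (δ One.x)) (K * N₂ + K * N₁) 0 pay-both-ways))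

    0<N₁ : 0 < N₁
    0<N₁ = 0<size (Hosted One.x) {u₁} (∧-true u₁∈ (T-sym (FarHost.to-host (far-host u₁∈))))

    impossible : ⊥
    impossible = [ (λ K≡0 → distinct (δ≡0⇒≡ K≡0)) , (λ N₁≡0 → <⇒≢ 0<N₁ (sym N₁≡0)) ]′ K≡0⊎N₁≡0
      where
        K≡0⊎N₁≡0 : K ≡ 0 ⊎ N₁ ≡ 0
        K≡0⊎N₁≡0 = m*n≡0⇒m≡0∨n≡0 K K*N₁≡0

  same-host : ∀ {u₁ u₂} (u₁∈ : Far u₁ ≡ true) (u₂∈ : Far u₂ ≡ true) → host u₁∈ ≡ host u₂∈
  same-host u₁∈ u₂∈ with host u₁∈ ≟ host u₂∈
  ... | yes same = same
  ... | no distinct = ⊥-elim (HostSwap.impossible u₁∈ u₂∈ distinct)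

  record RootModuleHub : Set where
    field
      hub : Fin n
      root-hub : adj T r hub ≡ true
      hub∈D : D hub ≡ true
      Far-hangs : HangsAt (adj T) Far hub
      hub-minimal : ∀ {w} → adj T r w ≡ true → D w ≡ true → sumOutside Far (δ hub) ≤ sumOutside Far (δ w)
      Far-at-hub : ∀ {v} → Far v ≡ true → NbhdIsSingleton T v hub

  near-root∉Far : ∀ {w} → adj T r w ≡ true → Far w ≡ false
  near-root∉Far {w} rw with Far w in w∈
  ... | false = refl
  ... | true = contradiction (trans (sym rw) (Far⇒r≁ w∈)) true≢false

  hub-from-far : ∀ {u₀} → Far u₀ ≡ true → RootModuleHub
  hub-from-far {u₀} u₀∈ = record
    { hub = c
    ; root-hub = FarHost.root-host h₀
    ; hub∈D = d⇒D (branching⇒d c∉Mᵢ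
        (2≤deg T (T-sym (FarHost.root-host h₀)) (T-sym (FarHost.to-host h₀)) (Far⇒≢r u₀∈ ∘ sym)))
    ; Far-hangs = record { anchor∉ = ∉Mᵢ⇒∉Far c∉Mᵢ ; exit = λ s∈ _ st → at-hub s∈ st }
    ; hub-minimal = λ {w} rw w∈D → move-far Far (λ s∈ → s∈) (λ s∈ → hub-neighbour s∈) u₀∈ rw
        (λ w∈Mᵢ → T-irrefl rw (sym (D∩Mᵢ⇒r w∈D w∈Mᵢ))) c∉Mᵢ
    ; Far-at-hub = λ v∈ w → at-hub v∈ , λ { refl → hub-neighbour v∈ }
    }
    where
      h₀ = far-host u₀∈
      c = FarHost.host h₀
      c∉Mᵢ : part c ≢ i
      c∉Mᵢ = FarHost.host∉Mᵢ h₀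
      at-hub : ∀ {s t} → (s∈ : Far s ≡ true) → adj T s t ≡ true → t ≡ c
      at-hub s∈ st = trans (FarHost.only-host (far-host s∈) st) (same-host s∈ u₀∈)
      hub-neighbour : ∀ {s} → Far s ≡ true → adj T s c ≡ true
      hub-neighbour s∈ = subst (λ t → adj T _ t ≡ true) (same-host s∈ u₀∈) (FarHost.to-host (far-host s∈))

  hub-without-far : (∀ u → Far u ≡ false) → RootModuleHub
  hub-without-far none with root-path-in-D (d∈D (proj₁ another-module))
  ... | q , q-path , (q-head , q-last) , in-D with head-just q q-head
  ...   | [] , refl = ⊥-elim (proj₂ another-module (trans (sym (d-part _)) (cong part (sym (Maybe.just-injective q-last)))))
  ...   | y ∷ _ , refl with argmin-on (λ w → adj T r w ∧ D w) (λ w → sumOutside Far (δ w))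
                              (∧-true (Linked.head (proj₂ (proj₁ q-path))) (All.lookup in-D (there (here refl))))
  ...     | c , candidate , minimal = record
    { hub = c
    ; root-hub = ∧-trueˡ candidate
    ; hub∈D = ∧-trueʳ {adj T r c} candidate
    ; Far-hangs = record { anchor∉ = none c ; exit = λ {s} s∈ → contradiction (trans (sym s∈) (none s)) true≢false }
    ; hub-minimal = λ rw w∈D → minimal (∧-true rw w∈D)
    ; Far-at-hub = λ {v} v∈ → contradiction (trans (sym v∈) (none v)) true≢false
    }

  root-module-hub : RootModuleHub
  root-module-hub with any Far (allFin n) in some
  ... | true = hub-from-far (proj₂ (any-allFin⁻ Far some))
  ... | false = hub-without-far λ u → Bool.¬-not λ u∈ → true≢false (trans (sym (any-allFin⁺ Far u u∈)) some)

  distSum-R : ∀ {h w} → HangsAt (adj T) Far h → Far w ≡ false →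
    distSum (Rset part T r) (adj T) w ≡ just (sumOutside Far (δ w))
  distSum-R {w = w} hangs w∉ =
    trans (Σ∞-finite (∁ Far) _ (λ u → δ u w)
             λ u u∈R → Hanging.Distances.dist-outside hangs (Graph.sym T) T-walk (not-true u∈R) w∉)
          (cong just (sum-cong-≗ pointwise))
    where
      pointwise : ∀ u → (if not (Far u) then δ u w else 0) ≡ (if Far u then 0 else δ w u)
      pointwise u with Far u
      ... | true = refl
      ... | false = δ-sym u w

  root-module-leaves : Σ (Fin n) (λ c → (adj T r c ≡ true) × (Dset d c ≡ true) ×
      (∀ w → adj T r w ≡ true → Dset d w ≡ true → distSum (Rset part T r) (adj T) c ≤∞ distSum (Rset part T r) (adj T) w) ×
      (∀ v → part v ≡ part r → v ≢ r → adj T r v ≡ false → deg T v ≡ 1 → NbhdIsSingleton T v c))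
  root-module-leaves = hub , root-hub , hub∈D ,
    (λ w rw w∈D → subst₂ _≤∞_ (sym (distSum-R Far-hangs (near-root∉Far root-hub)))
                              (sym (distSum-R Far-hangs (near-root∉Far rw)))
                             (hub-minimal rw w∈D)) ,
    λ v v∈Mᵢ v≢r rv _ → Far-at-hub (Far-intro v∈Mᵢ v≢r rv)
    where open RootModuleHub root-module-hub

lemma6 : ∀ {n k} (G : Graph n) (part : Fin n → Fin k) (T : Graph n) (r : Fin n)
    (d : Fin k → Fin n) →
    Connected allV (adj G) →
    IsModularPartition G part →
    IsMAD G T →
    IsPolyStar part T →
    IsRoot G T r →
    (∀ j → part (d j) ≡ j) →
    d (part r) ≡ r →
    (∀ j → j ≢ part r → ∀ v → part v ≡ j → deg T v ≤ deg T (d j)) →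
    -- (i) T[D] is a tree
    IsTree (Dset d) (adj T) ×
    -- (ii) non-root modules
    (∀ j → j ≢ part r → ∀ p → IsPath (Dset d) (adj T) p → Ends p r (d j) →
      Σ (Fin n) (λ c → (c ∈ p) × (adj T c (d j) ≡ true) ×
        (∀ c' → c' ∈ p → adj T c' (d j) ≡ true → c' ≡ c) ×
        (∀ v → part v ≡ j → v ≢ d j → deg T v ≡ 1 → NbhdIsSingleton T v c))) ×
    -- (iii) root module
    Σ (Fin n) (λ c → (adj T r c ≡ true) × (Dset d c ≡ true) ×
      (∀ w → adj T r w ≡ true → Dset d w ≡ true → distSum (Rset part T r) (adj T) c ≤∞ distSum (Rset part T r) (adj T) w) ×
      (∀ v → part v ≡ part r → v ≢ r → adj T r v ≡ false → deg T v ≡ 1 → NbhdIsSingleton T v c))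
-- The connectivity of G is implied by the spanning tree T.
lemma6 G part T r d _ modular mad poly-star root d-part d-root d-max = D-tree , non-root-module-leaves , root-module-leaves
  where open PolyStarMAD G part T r d modular mad poly-star root d-part d-root d-max
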